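{- Assume $p>4d-\varepsilon(u)$. Let $n\ge1$ be an integer. For each $1\le i\le b$ let $R_i$ be a finite subset of $\{1,\dots,a\}\times(\frac{s_i}{q-1}+\mathbb N)$ of cardinality $an$, let $R=\bigcup_{i=1}^bR_i$ and let $\tau$ be a permutation of $R$. Then $$\sum_{i=1}^b\sum_{l\in R_i}\Big\lceil\frac{p\phi_i(l)-\phi_{i(\tau(l))}(\tau(l))+u_{b-i}}{d}\Big\rceil\ \ge\ ab\,P_{[0,d],u}(n)+\#\{l\in R:\phi_{i(l)}(l)>n-1\}.$$
   Context: Let $p$ be a prime, $q=p^a$, $d\ge1$, $0\le u\le q-2$ with digits $u=\sum_{j=0}^{a-1}u_jp^j$ extended by $u_{j+a}=u_j$; $b$ least positive integer with $p^bu\equiv u\pmod{q-1}$ (so $u_{j+b}=u_j$). For $i\in\mathbb N$, $p^iu=q_i(q-1)+s_i$ with $0\le s_i<q-1$. For real $x$: $\{x\}$ fractional part, $\lceil x\rceil$ ceiling, $\{x\}'=1+x-\lceil x\rceil$; $\varepsilon(u)=\min\{d\{u_i/d\}':1\le i\le b\}$. The $R_i$ are pairwise disjoint; $i(l)=i$ for $l\in R_i$; $\phi_i:\{1,\dots,a\}\times(\frac{s_i}{q-1}+\mathbb N)\to\mathbb N$, $(\cdot,\frac{s_i}{q-1}+k)\mapsto k$. Arithmetic polygon: for $0\le i\le b-1$, $\delta^{(i)}_{\in}(0)=0$ and for $m\ge1$, $\delta^{(i)}_{\in}(m)=1$ if some integer $0\le l<d\{m/d\}$ has $pl+u_{b-i}\equiv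 m\pmod d$, else $0$; $\omega(m)=\frac1b\sum_{i=0}^{b-1}(\lceil\frac{(p-1)m+u_{b-i}}{d}\rceil-\delta^{(i)}_{\in}(m))$; $P_{[0,d],u}(n)=\sum_{k=0}^{n-1}\omega(k)$. -}

module Defs where

open import Data.Nat as ℕ using (ℕ; zero; suc; NonZero; _^_; _∸_; _%_)
open import Data.Nat.DivMod using ()
open import Data.Nat.Properties using (m^n≢0)
open import Data.Integer as ℤ using (ℤ; +_)
open import Data.Rational as ℚ using (ℚ; 0ℚ; 1ℚ; _/_; _+_; _-_; _*_; _⊓_; ceiling)
open import Data.Fin using (Fin; toℕ)
open import Data.Product using (_×_; proj₂)
open import Data.List using (List; map; foldr; upTo; allFin)
open import Data.List.Relation.Unary.Any using (any?)
open import Data.Bool using (if_then_else_)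
open import Relation.Nullary using (does)

ℤtoℚ : ℤ → ℚ
ℤtoℚ z = z / 1

ℕtoℚ : ℕ → ℚ
ℕtoℚ n = (+ n) / 1

⌈_⌉ℚ : ℚ → ℚ
⌈ x ⌉ℚ = ℤtoℚ (ceiling x)

fracP : ℚ → ℚ
fracP x = 1ℚ + x - ⌈ x ⌉ℚ

sumℚ : List ℚ → ℚ
sumℚ = foldr _+_ 0ℚ

ΣFin : (n : ℕ) → (Fin n → ℚ) → ℚ
ΣFin n f = sumℚ (map f (allFin n))

Σ< : ℕ → (ℕ → ℚ) → ℚ
Σ< n f = sumℚ (map f (upTo n))

-- base-p digit u_j of u (0 ≤ u < p^a), extended periodically: u_{j+a} = u_j
digit : (p a u j : ℕ) → .{{NonZero p}} → .{{NonZero a}} → ℕ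
digit p a u j = (ℕ._/_ u (p ^ (j % a)) {{m^n≢0 p (j % a)}}) % p

epsilon : (p a d u b : ℕ) → .{{NonZero p}} → .{{NonZero a}} → .{{NonZero d}} → ℚ
epsilon p a d u b = foldr _⊓_ (term 1) (map (λ k → term (suc k)) (upTo b))
  where
  term : ℕ → ℚ
  term i = ℕtoℚ d * fracP ((+ digit p a u i) / d)

deltaIn : (p a d u b i m : ℕ) → .{{NonZero p}} → .{{NonZero a}} → .{{NonZero d}} → ℚ
deltaIn p a d u b i zero = 0ℚ
deltaIn p a d u b i (suc m') =
  if does (any? (λ l → (p ℕ.* l ℕ.+ digit p a u (b ∸ i)) % d ℕ.≟ m % d) (upTo (m % d)))
  then 1ℚ else 0ℚ
  where m = suc m'

omega : (p a d u b m : ℕ) → .{{NonZero p}} → .{{NonZero a}} → .{{NonZero d}} → .{{NonZero b}} → ℚ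
omega p a d u b m =
  ((+ 1) / b) * Σ< b (λ i → ⌈ (+ ((p ∸ 1) ℕ.* m ℕ.+ digit p a u (b ∸ i))) / d ⌉ℚ - deltaIn p a d u b i m)

arithPolygon : (p a d u b n : ℕ) → .{{NonZero p}} → .{{NonZero a}} → .{{NonZero d}} → .{{NonZero b}} → ℚ
arithPolygon p a d u b n = Σ< n (λ k → omega p a d u b k)

-- φ: second component (the integer k of s_i/(q-1) + k)
φ : {A : Set} → A × ℕ → ℕ
φ = proj₂

module Submission where

-- Write ρ = n mod d, θ = d - ρ and, for a digit c, introduce the step functions
--   G_c(x) = ⌊(px + c + θ)/d⌋,   H(x) = ⌊(x + θ)/d⌋,   F_c = G_c - H.
-- (1) Termwise ⌈(px - y + c)/d⌉ ≥ G_c(x) - H(y); as τ permutes the indices, the H-terms cancel in the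
--     sum, so the left-hand side is at least ∑_{i,t} F_{c_i}(x_{it}).
-- (2) p ≥ 2d makes F_c strictly increasing, so for an injection of a·n indices into Fin a × ℕ the sum of F
--     is at least a·∑_{k<n} F(k) plus the number of values beyond n - 1 (a rearrangement inequality).
-- (3) As d < p is coprime to p, k ↦ (pk + c) mod d permutes the residues, and counting residues gives
--     ∑_{k<n} ⌈((p-1)k + c)/d⌉ ≤ ∑_{k<n} F_c(k) + ∑_{k<n} δ_∈(k).
-- (4) By the digit period u_b = u_0 the digits u_b, ..., u_1 of the polygon are u_{b-1}, ..., u_0, so
--     ab·P(n) = a·∑_i ∑_{k<n} (⌈((p-1)k + u_i)/d⌉ - δ_∈(k)); (1)-(3) then give an inequality of integers,
--     which the order-preserving ring embedding ℤ → ℚ carries to the statement.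


module FiniteSums where

  open import Data.Nat using (ℕ; zero; suc; _+_; _*_; _∸_; _≤_; z≤n)
  open import Data.Nat.Properties
  open import Data.Nat.Tactic.RingSolver using (solve-∀)
  open import Data.Fin as Fin using (Fin; toℕ)
  open import Data.List using (List; []; _∷_; _++_; map; length; cartesianProduct; allFin; upTo; applyUpTo; tabulate)
  open import Data.List.Properties using (map-upTo; map-tabulate; map-∘)
  open import Data.List.Membership.Propositional using (_∈_)
  open import Data.List.Relation.Unary.Any using (here; there)
  import Data.List.Relation.Unary.All as All
  open import Data.List.Relation.Unary.Unique.Propositional using (Unique; _∷_)
  open import Data.Product using (_×_; _,_)
  open import Data.Sum using (_⊎_; inj₁; inj₂)
  open import Data.Empty using (⊥-elim)
  open import Relation.Nullary using (Dec; yes; no)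
  open import Relation.Binary.Definitions using (DecidableEquality)
  open import Relation.Binary.PropositionalEquality
  open import Function.Bundles using (_↔_; Inverse; Injection)
  open import Function.Properties.Inverse using (↔⇒↣; ↔-sym)

  ∑ : {A : Set} → List A → (A → ℕ) → ℕ
  ∑ []       f = 0
  ∑ (x ∷ xs) f = f x + ∑ xs f

  syntax ∑ xs (λ x → e) = ∑[ x ← xs ] e

  ind : {P : Set} → Dec P → ℕ
  ind (yes _) = 1
  ind (no _)  = 0

  ∑-++ : {A : Set} (xs ys : List A) (f : A → ℕ) → ∑ (xs ++ ys) f ≡ ∑ xs f + ∑ ys f
  ∑-++ []       ys f = refl
  ∑-++ (x ∷ xs) ys f = trans (cong (f x +_) (∑-++ xs ys f)) (sym (+-assoc (f x) _ _))

  ∑-map : {A B : Set} (g : A → B) (xs : List A) (f : B → ℕ) → ∑ (map g xs) f ≡ ∑[ x ← xs ] f (g x)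
  ∑-map g []       f = refl
  ∑-map g (x ∷ xs) f = cong (f (g x) +_) (∑-map g xs f)

  ∑-cong : {A : Set} (xs : List A) {f g : A → ℕ} → (∀ {x} → x ∈ xs → f x ≡ g x) → ∑ xs f ≡ ∑ xs g
  ∑-cong []       h = refl
  ∑-cong (x ∷ xs) h = cong₂ _+_ (h (here refl)) (∑-cong xs (λ m → h (there m)))

  ∑-mono : {A : Set} (xs : List A) {f g : A → ℕ} → (∀ {x} → x ∈ xs → f x ≤ g x) → ∑ xs f ≤ ∑ xs g
  ∑-mono []       h = z≤n
  ∑-mono (x ∷ xs) h = +-mono-≤ (h (here refl)) (∑-mono xs (λ m → h (there m)))

  ∑-+ : {A : Set} (xs : List A) (f g : A → ℕ) → ∑[ x ← xs ] (f x + g x) ≡ ∑ xs f + ∑ xs g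
  ∑-+ []       f g = refl
  ∑-+ (x ∷ xs) f g = trans (cong (f x + g x +_) (∑-+ xs f g)) (interchange (f x) (g x) _ _)
    where
    interchange : ∀ a b c d → a + b + (c + d) ≡ a + c + (b + d)
    interchange = solve-∀

  ∑-*ˡ : {A : Set} (xs : List A) (k : ℕ) (f : A → ℕ) → ∑[ x ← xs ] (k * f x) ≡ k * ∑ xs f
  ∑-*ˡ []       k f = sym (*-zeroʳ k)
  ∑-*ˡ (x ∷ xs) k f = trans (cong (k * f x +_) (∑-*ˡ xs k f)) (sym (*-distribˡ-+ k (f x) (∑ xs f)))

  ∑-const : {A : Set} (xs : List A) (k : ℕ) → ∑[ x ← xs ] k ≡ length xs * k
  ∑-const []       k = refl
  ∑-const (x ∷ xs) k = cong (k +_) (∑-const xs k)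

  ∑-swap : {A B : Set} (xs : List A) (ys : List B) (h : A → B → ℕ) →
           ∑[ x ← xs ] ∑[ y ← ys ] h x y ≡ ∑[ y ← ys ] ∑[ x ← xs ] h x y
  ∑-swap []       ys h = sym (trans (∑-const ys 0) (*-zeroʳ (length ys)))
  ∑-swap (x ∷ xs) ys h =
    trans (cong (∑ ys (h x) +_) (∑-swap xs ys h)) (sym (∑-+ ys (h x) (λ y → ∑[ x′ ← xs ] h x′ y)))

  ∑-cartesianProduct : {A B : Set} (xs : List A) (ys : List B) (f : A × B → ℕ) →
                       ∑ (cartesianProduct xs ys) f ≡ ∑[ x ← xs ] ∑[ y ← ys ] f (x , y)
  ∑-cartesianProduct []       ys f = refl
  ∑-cartesianProduct (x ∷ xs) ys f =
    trans (∑-++ (map (x ,_) ys) _ f) (cong₂ _+_ (∑-map (x ,_) ys f) (∑-cartesianProduct xs ys f))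

  ∑-upTo-suc : ∀ m (h : ℕ → ℕ) → ∑ (upTo (suc m)) h ≡ h 0 + ∑[ i ← upTo m ] h (suc i)
  ∑-upTo-suc m h = cong (h 0 +_) (trans (cong (λ l → ∑ l h) (sym (map-upTo suc m))) (∑-map suc (upTo m) h))

  ∑-upTo-+ : ∀ m j (h : ℕ → ℕ) → ∑ (upTo (m + j)) h ≡ ∑ (upTo m) h + ∑[ i ← upTo j ] h (m + i)
  ∑-upTo-+ zero    j h = refl
  ∑-upTo-+ (suc m) j h = begin
    ∑ (upTo (suc m + j)) h                                  ≡⟨ ∑-upTo-suc (m + j) h ⟩
    h 0 + ∑[ i ← upTo (m + j) ] h (suc i)                   ≡⟨ cong (h 0 +_) (∑-upTo-+ m j (λ i → h (suc i))) ⟩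
    h 0 + (∑[ i ← upTo m ] h (suc i) + ∑[ i ← upTo j ] h (suc m + i)) ≡⟨ sym (+-assoc (h 0) _ _) ⟩
    h 0 + ∑[ i ← upTo m ] h (suc i) + ∑[ i ← upTo j ] h (suc m + i)
      ≡⟨ cong (_+ ∑[ i ← upTo j ] h (suc m + i)) (sym (∑-upTo-suc m h)) ⟩
    ∑ (upTo (suc m)) h + ∑[ i ← upTo j ] h (suc m + i)      ∎
    where open ≡-Reasoning

  ∑-rotate : ∀ (ψ : ℕ → ℕ) b → ψ b ≡ ψ 0 → ∑[ i ← upTo b ] ψ (b ∸ i) ≡ ∑[ i ← upTo b ] ψ (b ∸ suc i)
  ∑-rotate ψ b ψb≡ψ0 = +-cancelʳ-≡ (ψ 0) _ _
    (trans (exchange b) (trans (cong (_+ ∑[ i ← upTo b ] ψ (b ∸ suc i)) ψb≡ψ0) (+-comm (ψ 0) _)))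
    where
    exchange : ∀ b → ∑[ i ← upTo b ] ψ (b ∸ i) + ψ 0 ≡ ψ b + ∑[ i ← upTo b ] ψ (b ∸ suc i)
    exchange zero    = +-comm 0 (ψ 0)
    exchange (suc b) = begin
      ∑[ i ← upTo (suc b) ] ψ (suc b ∸ i) + ψ 0          ≡⟨ cong (_+ ψ 0) (∑-upTo-suc b _) ⟩
      ψ (suc b) + ∑[ i ← upTo b ] ψ (b ∸ i) + ψ 0         ≡⟨ +-assoc (ψ (suc b)) _ _ ⟩
      ψ (suc b) + (∑[ i ← upTo b ] ψ (b ∸ i) + ψ 0)       ≡⟨ cong (ψ (suc b) +_) (exchange b) ⟩
      ψ (suc b) + (ψ b + ∑[ i ← upTo b ] ψ (b ∸ suc i))   ≡⟨ cong (ψ (suc b) +_) (sym (∑-upTo-suc b _)) ⟩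
      ψ (suc b) + ∑[ i ← upTo (suc b) ] ψ (suc b ∸ suc i) ∎
      where open ≡-Reasoning

  ∑-allFin : ∀ m (f : ℕ → ℕ) → ∑[ i ← allFin m ] f (toℕ i) ≡ ∑ (upTo m) f
  ∑-allFin m f = trans (sym (∑-map toℕ (allFin m) f)) (cong (λ l → ∑ l f) (toℕ-allFin m))
    where
    toℕ-allFin : ∀ m → map toℕ (allFin m) ≡ upTo m
    toℕ-allFin zero    = refl
    toℕ-allFin (suc m) = cong (0 ∷_) (begin
      map toℕ (tabulate Fin.suc)     ≡⟨ map-tabulate Fin.suc toℕ ⟩
      tabulate (λ i → suc (toℕ i))   ≡⟨ sym (map-tabulate (λ i → i) (λ i → suc (toℕ i))) ⟩
      map (λ i → suc (toℕ i)) (allFin m) ≡⟨ map-∘ (allFin m) ⟩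
      map suc (map toℕ (allFin m))   ≡⟨ cong (map suc) (toℕ-allFin m) ⟩
      map suc (upTo m)               ≡⟨ map-upTo suc m ⟩
      applyUpTo suc m                ∎)
      where open ≡-Reasoning

  InjectiveOn : {I X : Set} → List I → (I → X) → Set
  InjectiveOn ls f = ∀ {s s′} → s ∈ ls → s′ ∈ ls → f s ≡ f s′ → s ≡ s′

  -- Proof: expand D (f s) as a sum over L
  -- with the indicator of x = f s, swap the sums, and note that each x is hit at most once.
  ∑-injection : {I X : Set} (_≟_ : DecidableEquality X) (ls : List I) (L : List X)
                (f : I → X) (g : I → ℕ) (D : X → ℕ) →
                Unique ls → InjectiveOn ls f → (∀ {s} → s ∈ ls → g s ≤ D (f s)) →
                (∀ {s} → s ∈ ls → g s ≡ 0 ⊎ f s ∈ L) → ∑ ls g ≤ ∑ L D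
  ∑-injection {X = X} _≟_ ls L f g D uniq inj g≤Df inL = begin
    ∑ ls g                                            ≤⟨ ∑-mono ls expand ⟩
    ∑[ s ← ls ] ∑[ x ← L ] (ind (f s ≟ x) * D x)      ≡⟨ ∑-swap ls L _ ⟩
    ∑[ x ← L ] ∑[ s ← ls ] (ind (f s ≟ x) * D x)      ≡⟨ ∑-cong L (λ {x} _ → pull x) ⟩
    ∑[ x ← L ] (D x * ∑[ s ← ls ] ind (f s ≟ x))      ≤⟨ ∑-mono L (λ {x} _ → *-monoʳ-≤ (D x) (fibre≤1 ls uniq inj x)) ⟩
    ∑[ x ← L ] (D x * 1)                              ≡⟨ ∑-cong L (λ {x} _ → *-identityʳ (D x)) ⟩
    ∑ L D                                             ∎
    where
    open ≤-Reasoning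

    member : ∀ (L : List X) z → z ∈ L → D z ≤ ∑[ x ← L ] (ind (z ≟ x) * D x)
    member (x ∷ L) z (here refl) with z ≟ z
    ... | yes _  = ≤-trans (m≤m+n (D z) 0) (m≤m+n _ _)
    ... | no z≢z = ⊥-elim (z≢z refl)
    member (x ∷ L) z (there z∈L) = ≤-trans (member L z z∈L) (m≤n+m _ _)

    expand : ∀ {s} → s ∈ ls → g s ≤ ∑[ x ← L ] (ind (f s ≟ x) * D x)
    expand {s} s∈ls with inL s∈ls
    ... | inj₁ g≡0  = ≤-trans (≤-reflexive g≡0) z≤n
    ... | inj₂ f∈L  = ≤-trans (g≤Df s∈ls) (member L (f s) f∈L)

    pull : ∀ x → ∑[ s ← ls ] (ind (f s ≟ x) * D x) ≡ D x * ∑[ s ← ls ] ind (f s ≟ x)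
    pull x = trans (∑-cong ls (λ {s} _ → *-comm (ind (f s ≟ x)) (D x))) (∑-*ˡ ls (D x) _)

    fibre≤1 : ∀ ls → Unique ls → InjectiveOn ls f → ∀ x → ∑[ s ← ls ] ind (f s ≟ x) ≤ 1
    fibre≤1 []       _            _   x = z≤n
    fibre≤1 (s ∷ ls) (s∉ls ∷ uniq) inj x with f s ≟ x
    ... | yes fs≡x = ≤-reflexive (cong suc (trans (∑-cong ls missed) (trans (∑-const ls 0) (*-zeroʳ (length ls)))))
      where
      missed : ∀ {s′} → s′ ∈ ls → ind (f s′ ≟ x) ≡ 0
      missed {s′} s′∈ls with f s′ ≟ x
      ... | no _      = refl
      ... | yes fs′≡x = ⊥-elim (All.lookup s∉ls s′∈ls (inj (here refl) (there s′∈ls) (trans fs≡x (sym fs′≡x))))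
    ... | no _ = fibre≤1 ls uniq (λ m m′ e → inj (there m) (there m′) e) x

  module _ {A : Set} (_≟_ : DecidableEquality A) (xs : List A) (uniq : Unique xs) (complete : ∀ z → z ∈ xs) where

    -- τ is injective with values in xs; the reverse inequality is this one for τ⁻¹
    ∑-permute-≤ : (τ : A ↔ A) (h : A → ℕ) → ∑[ z ← xs ] h (Inverse.to τ z) ≤ ∑ xs h
    ∑-permute-≤ τ h = ∑-injection _≟_ xs xs (Inverse.to τ) _ h uniq
      (λ _ _ → Injection.injective (↔⇒↣ τ)) (λ _ → ≤-refl) (λ {s} _ → inj₂ (complete (Inverse.to τ s)))

    ∑-permute : (τ : A ↔ A) (h : A → ℕ) → ∑[ z ← xs ] h (Inverse.to τ z) ≡ ∑ xs h
    ∑-permute τ h = ≤-antisym (∑-permute-≤ τ h) (begin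
      ∑ xs h                                              ≡⟨ ∑-cong xs (λ {z} _ → cong h (sym (Inverse.strictlyInverseˡ τ z))) ⟩
      ∑[ z ← xs ] h (Inverse.to τ (Inverse.from τ z))     ≤⟨ ∑-permute-≤ (↔-sym τ) (λ z → h (Inverse.to τ z)) ⟩
      ∑[ z ← xs ] h (Inverse.to τ z)                      ∎)
      where open ≤-Reasoning

module CeilingBounds where

  open import Data.Nat as ℕ using (ℕ; suc; NonZero)
  import Data.Nat.Properties as ℕ
  open import Data.Integer using (+_; _+_; _*_; -_; _≤_; _<_; +≤+; +<+; 1ℤ; ∣_∣)
  open import Data.Integer.Base using () renaming (suc to sucℤ)
  open import Data.Integer.Properties
  open import Data.Integer.DivMod using (div-pos-is-/ℕ; [n/ℕd]*d≤n; n<s[n/ℕd]*d)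
  open import Data.Nat.DivMod using (m≡m%n+[m/n]*n; m%n<n; m/n*n≤m)
  open import Data.Integer.Tactic.RingSolver using (solve-∀)
  open import Data.Rational as ℚ using (mkℚ; ↥_; ↧_; floor; ceiling)
  import Data.Rational.Properties as ℚ
  open import Data.Product using (_×_; _,_; proj₁; proj₂)
  open import Relation.Binary.PropositionalEquality

  floor-bounds : ∀ q → floor q * ↧ q ≤ ↥ q × ↥ q < (1ℤ + floor q) * ↧ q
  floor-bounds (mkℚ n d-1 _) rewrite div-pos-is-/ℕ n (suc d-1) ⦃ _ ⦄ =
    [n/ℕd]*d≤n n (suc d-1) , n<s[n/ℕd]*d n (suc d-1)

  -- ⌈q⌉ = -⌊-q⌋ is the least integer c with ↥q ≤ c ↧q.
  ceiling-bounds : ∀ q → ↥ q ≤ ceiling q * ↧ q × ceiling q * ↧ q < ↥ q + ↧ q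
  ceiling-bounds q@(mkℚ n _ _) = lower , upper
    where
    D = ↧ q
    F = floor (ℚ.- q)
    neg-num : ↥ (ℚ.- q) ≡ - n
    neg-num = ℚ.↥-neg q
    neg-den : ↧ (ℚ.- q) ≡ D
    neg-den = ℚ.↧-neg q
    F-lower : F * D ≤ - n
    F-lower = subst₂ (λ e m → F * e ≤ m) neg-den neg-num (proj₁ (floor-bounds (ℚ.- q)))
    F-upper : - n < (1ℤ + F) * D
    F-upper = subst₂ (λ m e → m < (1ℤ + F) * e) neg-num neg-den (proj₂ (floor-bounds (ℚ.- q)))
    lower : n ≤ ceiling q * D
    lower = subst₂ _≤_ (neg-involutive n) (neg-distribˡ-* F D) (neg-mono-≤ F-lower)
    upper : ceiling q * D < n + D
    upper = subst₂ _<_ (shift F D) (cong (_+ D) (neg-involutive n)) (+-monoˡ-< D (neg-mono-< F-upper))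
      where
      shift : ∀ F D → - ((1ℤ + F) * D) + D ≡ - F * D
      shift = solve-∀

  ceiling-/-bounds : ∀ z d .{{_ : NonZero d}} →
                     z ≤ ceiling (z ℚ./ d) * + d × ceiling (z ℚ./ d) * + d < z + + d
  ceiling-/-bounds z d@(suc _) with ceiling-bounds (z ℚ./ d)
  ... | lo , hi = lower , upper
    where
    q = z ℚ./ d
    C = ceiling q
    -- the reduced fraction ↥q/↧q is z/d divided by g = gcd z d
    num : ↥ q * + d ≡ z * ↧ q
    num = trans (cong (↥ q *_) (sym (ℚ.↧-/ z d))) (trans (regroup (↥ q) (↧ q) _) (cong (_* ↧ q) (ℚ.↥-/ z d)))
      where
      regroup : ∀ a b g → a * (b * g) ≡ (a * g) * b
      regroup = solve-∀
    den : (↥ q + ↧ q) * + d ≡ (z + + d) * ↧ q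
    den = trans (*-distribʳ-+ (+ d) (↥ q) (↧ q))
            (trans (cong₂ _+_ num (*-comm (↧ q) (+ d))) (sym (*-distribʳ-+ (↧ q) z (+ d))))
    swap : ∀ C b d → C * b * d ≡ (C * d) * b
    swap = solve-∀
    lower : z ≤ C * + d
    lower = *-cancelʳ-≤-pos z (C * + d) (↧ q)
      (subst₂ _≤_ num (swap C (↧ q) (+ d)) (*-monoʳ-≤-nonNeg (+ d) lo))
    upper : C * + d < z + + d
    upper = *-cancelʳ-<-nonNeg (↧ q) (subst₂ _<_ (swap C (↧ q) (+ d)) den (*-monoʳ-<-pos (+ d) hi))

  ⌈_/_⌉ℕ : ℕ → (d : ℕ) → .{{NonZero d}} → ℕ
  ⌈ m / d ⌉ℕ = ∣ ceiling (+ m ℚ./ d) ∣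

  ceiling-ℕ : ∀ m d .{{_ : NonZero d}} → ceiling (+ m ℚ./ d) ≡ + ⌈ m / d ⌉ℕ
  ceiling-ℕ m d = sym (0≤i⇒+∣i∣≡i (nonNeg-cancel _ d (≤-trans (+≤+ ℕ.z≤n) (proj₁ (ceiling-/-bounds (+ m) d)))))
    where
    nonNeg-cancel : ∀ z d .{{_ : NonZero d}} → + 0 ≤ z * + d → + 0 ≤ z
    nonNeg-cancel z (suc d) = *-cancelʳ-≤-pos (+ 0) z (+ suc d)

  ⌈/⌉ℕ-upper : ∀ m d .{{_ : NonZero d}} → ⌈ m / d ⌉ℕ ℕ.* d ℕ.< m ℕ.+ d
  ⌈/⌉ℕ-upper m d = drop‿+<+ (subst₂ _<_ (trans (cong (_* + d) (ceiling-ℕ m d)) (sym (pos-* ⌈ m / d ⌉ℕ d)))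
                                        (sym (pos-+ m d)) (proj₂ (ceiling-/-bounds (+ m) d)))

  floor≤ceiling+floor : ∀ z w m d .{{_ : NonZero d}} → z + + w ≡ + m → + (m ℕ./ d) ≤ ceiling (z ℚ./ d) + + (w ℕ./ d)
  floor≤ceiling+floor z w m d z+w≡m =
    subst₂ _≤_ (pred-suc (+ (m ℕ./ d))) (pred-suc (C + + (w ℕ./ d))) (pred-mono (i<j⇒suc[i]≤j below))
    where
    open ≤-Reasoning
    C = ceiling (z ℚ./ d)
    collect : ∀ c q d → c * d + (q + 1ℤ) * d ≡ (1ℤ + (c + q)) * d
    collect = solve-∀
    w-upper : + w < (+ (w ℕ./ d) + 1ℤ) * + d
    w-upper = begin-strict
      + w                               ≡⟨ cong +_ (m≡m%n+[m/n]*n w d) ⟩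
      + (w ℕ.% d ℕ.+ w ℕ./ d ℕ.* d)     <⟨ +<+ (ℕ.+-monoˡ-< _ (m%n<n w d)) ⟩
      + (d ℕ.+ w ℕ./ d ℕ.* d)           ≡⟨ trans (pos-+ d _) (cong (λ s → + d + s) (pos-* (w ℕ./ d) d)) ⟩
      + d + + (w ℕ./ d) * + d           ≡⟨ distrib (+ (w ℕ./ d)) (+ d) ⟩
      (+ (w ℕ./ d) + 1ℤ) * + d          ∎
      where
      distrib : ∀ q d → d + q * d ≡ (q + 1ℤ) * d
      distrib = solve-∀
    below : + (m ℕ./ d) < sucℤ (C + + (w ℕ./ d))
    below = *-cancelʳ-<-nonNeg (+ d) (begin-strict
      + (m ℕ./ d) * + d                       ≡⟨ sym (pos-* (m ℕ./ d) d) ⟩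
      + (m ℕ./ d ℕ.* d)                       ≤⟨ +≤+ (m/n*n≤m m d) ⟩
      + m                                     ≡⟨ sym z+w≡m ⟩
      z + + w                                 <⟨ +-mono-≤-< (proj₁ (ceiling-/-bounds z d)) w-upper ⟩
      C * + d + (+ (w ℕ./ d) + 1ℤ) * + d      ≡⟨ collect C (+ (w ℕ./ d)) (+ d) ⟩
      sucℤ (C + + (w ℕ./ d)) * + d            ∎)

module IntegerEmbedding where

  open import Defs using (ℤtoℚ; sumℚ)
  open import Data.Nat as ℕ using (ℕ; suc; NonZero)
  open import Data.Integer as ℤ using (ℤ; +_)
  import Data.Integer.Properties as ℤ
  open import Data.Integer.Tactic.RingSolver using (solve-∀)
  open import Data.Rational as ℚ using (ℚ; _/_; toℚᵘ; 1ℚ)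
  import Data.Rational.Properties as ℚ
  open import Data.Rational.Unnormalised as ℚᵘ using (ℚᵘ; mkℚᵘ; *≡*; *≤*; *<*)
  import Data.Rational.Unnormalised.Properties as ℚᵘ
  open import Data.List using (List; []; _∷_; map)
  open FiniteSums using (∑)
  open import Relation.Binary.PropositionalEquality

  toℚᵘ-/ : ∀ z d .{{_ : NonZero d}} → toℚᵘ (z / d) ℚᵘ.≃ (z ℚᵘ./ d)
  toℚᵘ-/ z (suc d-1) = ℚ.toℚᵘ-fromℚᵘ (mkℚᵘ z d-1)

  /-≤ : ∀ {x y} d₁ d₂ .{{_ : NonZero d₁}} .{{_ : NonZero d₂}} → x ℤ.* + d₂ ℤ.≤ y ℤ.* + d₁ → x / d₁ ℚ.≤ y / d₂
  /-≤ {x} {y} d₁@(suc _) d₂@(suc _) le =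
    ℚ.toℚᵘ-cancel-≤ (ℚᵘ.≤-respˡ-≃ (ℚᵘ.≃-sym (toℚᵘ-/ x d₁)) (ℚᵘ.≤-respʳ-≃ (ℚᵘ.≃-sym (toℚᵘ-/ y d₂)) (*≤* le)))

  -- The embedding ℤ → ℚ, z ↦ z/1, is an order embedding and a ring homomorphism.
  -- Each identity is checked after passing to unnormalised rationals, where z/1 is literal.
  private
    ≃ᵘ⇒≡ℤtoℚ : ∀ {q} z → toℚᵘ q ℚᵘ.≃ mkℚᵘ z 0 → q ≡ ℤtoℚ z
    ≃ᵘ⇒≡ℤtoℚ z eq = ℚ.toℚᵘ-injective (ℚᵘ.≃-trans eq (ℚᵘ.≃-sym (toℚᵘ-/ z 1)))

  ℤtoℚ-mono-≤ : ∀ {x y} → x ℤ.≤ y → ℤtoℚ x ℚ.≤ ℤtoℚ y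
  ℤtoℚ-mono-≤ {x} {y} x≤y = /-≤ {x} {y} 1 1 (subst₂ ℤ._≤_ (sym (ℤ.*-identityʳ x)) (sym (ℤ.*-identityʳ y)) x≤y)

  ℤtoℚ-cancel-< : ∀ {x y} → ℤtoℚ x ℚ.< ℤtoℚ y → x ℤ.< y
  ℤtoℚ-cancel-< {x} {y} lt with ℚᵘ.<-respˡ-≃ (toℚᵘ-/ x 1) (ℚᵘ.<-respʳ-≃ (toℚᵘ-/ y 1) (ℚ.toℚᵘ-mono-< lt))
  ... | *<* x1<y1 = subst₂ ℤ._<_ (ℤ.*-identityʳ x) (ℤ.*-identityʳ y) x1<y1

  ℤtoℚ-+ : ∀ x y → ℤtoℚ (x ℤ.+ y) ≡ ℤtoℚ x ℚ.+ ℤtoℚ y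
  ℤtoℚ-+ x y = sym (≃ᵘ⇒≡ℤtoℚ (x ℤ.+ y) (ℚᵘ.≃-trans (ℚ.toℚᵘ-homo-+ (ℤtoℚ x) (ℤtoℚ y))
    (ℚᵘ.≃-trans (ℚᵘ.+-cong (toℚᵘ-/ x 1) (toℚᵘ-/ y 1)) (*≡* (ring x y)))))
    where
    ring : ∀ x y → (x ℤ.* + 1 ℤ.+ y ℤ.* + 1) ℤ.* + 1 ≡ (x ℤ.+ y) ℤ.* (+ 1 ℤ.* + 1)
    ring = solve-∀

  ℤtoℚ-neg : ∀ x → ℤtoℚ (ℤ.- x) ≡ ℚ.- ℤtoℚ x
  ℤtoℚ-neg x = sym (≃ᵘ⇒≡ℤtoℚ (ℤ.- x) (ℚᵘ.≃-trans (ℚ.toℚᵘ-homo‿- (ℤtoℚ x)) (ℚᵘ.-‿cong (toℚᵘ-/ x 1))))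

  ℤtoℚ-- : ∀ x y → ℤtoℚ (x ℤ.- y) ≡ ℤtoℚ x ℚ.- ℤtoℚ y
  ℤtoℚ-- x y = trans (ℤtoℚ-+ x (ℤ.- y)) (cong (ℤtoℚ x ℚ.+_) (ℤtoℚ-neg y))

  ℤtoℚ-* : ∀ x y → ℤtoℚ (x ℤ.* y) ≡ ℤtoℚ x ℚ.* ℤtoℚ y
  ℤtoℚ-* x y = sym (≃ᵘ⇒≡ℤtoℚ (x ℤ.* y) (ℚᵘ.≃-trans (ℚ.toℚᵘ-homo-* (ℤtoℚ x) (ℤtoℚ y))
    (ℚᵘ.≃-trans (ℚᵘ.*-cong (toℚᵘ-/ x 1) (toℚᵘ-/ y 1)) (*≡* (ring x y)))))
    where
    ring : ∀ x y → (x ℤ.* y) ℤ.* + 1 ≡ (x ℤ.* y) ℤ.* (+ 1 ℤ.* + 1)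
    ring = solve-∀

  ℤtoℚ-*-1/ : ∀ m .{{_ : NonZero m}} → ℤtoℚ (+ m) ℚ.* (+ 1 / m) ≡ 1ℚ
  ℤtoℚ-*-1/ m@(suc _) = ℚ.toℚᵘ-injective (ℚᵘ.≃-trans (ℚ.toℚᵘ-homo-* (ℤtoℚ (+ m)) (+ 1 / m))
    (ℚᵘ.≃-trans (ℚᵘ.*-cong (toℚᵘ-/ (+ m) 1) (toℚᵘ-/ (+ 1) m)) (*≡* (ring (+ m)))))
    where
    ring : ∀ m → (m ℤ.* + 1) ℤ.* + 1 ≡ + 1 ℤ.* (+ 1 ℤ.* m)
    ring = solve-∀

  ∑ℤ : {A : Set} → List A → (A → ℤ) → ℤ
  ∑ℤ []       f = + 0
  ∑ℤ (x ∷ xs) f = f x ℤ.+ ∑ℤ xs f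

  ∑ℤ-mono : {A : Set} (xs : List A) {f g : A → ℤ} → (∀ x → f x ℤ.≤ g x) → ∑ℤ xs f ℤ.≤ ∑ℤ xs g
  ∑ℤ-mono []       h = ℤ.≤-refl
  ∑ℤ-mono (x ∷ xs) h = ℤ.+-mono-≤ (h x) (∑ℤ-mono xs h)

  ∑ℤ-cong : {A : Set} (xs : List A) {f g : A → ℤ} → (∀ x → f x ≡ g x) → ∑ℤ xs f ≡ ∑ℤ xs g
  ∑ℤ-cong []       h = refl
  ∑ℤ-cong (x ∷ xs) h = cong₂ ℤ._+_ (h x) (∑ℤ-cong xs h)

  ∑ℤ-+ : {A : Set} (xs : List A) (f g : A → ℤ) → ∑ℤ xs (λ x → f x ℤ.+ g x) ≡ ∑ℤ xs f ℤ.+ ∑ℤ xs g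
  ∑ℤ-+ []       f g = refl
  ∑ℤ-+ (x ∷ xs) f g = trans (cong (λ s → f x ℤ.+ g x ℤ.+ s) (∑ℤ-+ xs f g)) (interchange (f x) (g x) _ _)
    where
    interchange : ∀ a b c d → a ℤ.+ b ℤ.+ (c ℤ.+ d) ≡ a ℤ.+ c ℤ.+ (b ℤ.+ d)
    interchange = solve-∀

  ∑ℤ-neg : {A : Set} (xs : List A) (f : A → ℤ) → ∑ℤ xs (λ x → ℤ.- f x) ≡ ℤ.- ∑ℤ xs f
  ∑ℤ-neg []       f = refl
  ∑ℤ-neg (x ∷ xs) f = trans (cong (λ s → ℤ.- f x ℤ.+ s) (∑ℤ-neg xs f)) (sym (ℤ.neg-distrib-+ (f x) (∑ℤ xs f)))

  ∑ℤ-ℕ : {A : Set} (xs : List A) (f : A → ℕ) → ∑ℤ xs (λ x → + f x) ≡ + ∑ xs f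
  ∑ℤ-ℕ []       f = refl
  ∑ℤ-ℕ (x ∷ xs) f = trans (cong (λ s → + f x ℤ.+ s) (∑ℤ-ℕ xs f)) (sym (ℤ.pos-+ (f x) (∑ xs f)))

  ∑ℤ-ℕ-∸ : {A : Set} (xs : List A) (f g : A → ℕ) → ∑ℤ xs (λ x → + f x ℤ.- + g x) ≡ + ∑ xs f ℤ.- + ∑ xs g
  ∑ℤ-ℕ-∸ xs f g = trans (∑ℤ-+ xs _ _) (cong₂ ℤ._+_ (∑ℤ-ℕ xs f) (trans (∑ℤ-neg xs _) (cong ℤ.-_ (∑ℤ-ℕ xs g))))

  ℤtoℚ-∑ : {A : Set} (xs : List A) (f : A → ℤ) → sumℚ (map (λ x → ℤtoℚ (f x)) xs) ≡ ℤtoℚ (∑ℤ xs f)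
  ℤtoℚ-∑ []       f = refl
  ℤtoℚ-∑ (x ∷ xs) f = trans (cong (ℤtoℚ (f x) ℚ.+_) (ℤtoℚ-∑ xs f)) (sym (ℤtoℚ-+ (f x) (∑ℤ xs f)))

  sumℚ-*ˡ : {A : Set} (xs : List A) (c : ℚ) (f : A → ℚ) → sumℚ (map (λ x → c ℚ.* f x) xs) ≡ c ℚ.* sumℚ (map f xs)
  sumℚ-*ˡ []       c f = sym (ℚ.*-zeroʳ c)
  sumℚ-*ˡ (x ∷ xs) c f = trans (cong (c ℚ.* f x ℚ.+_) (sumℚ-*ˡ xs c f)) (sym (ℚ.*-distribˡ-+ c (f x) _))

module Rearrangement where

  open import Data.Nat as ℕ using (ℕ; suc; _+_; _*_; _∸_; _≤_; _<_; s≤s; _<?_)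
  open import Data.Nat.Properties
  open import Data.Fin as Fin using (Fin)
  open import Data.List using (length; cartesianProduct; allFin; upTo)
  open import Data.List.Properties using (length-tabulate; length-upTo)
  open import Data.List.Membership.Propositional using (_∈_)
  open import Data.List.Membership.Propositional.Properties using (∈-allFin; ∈-upTo⁺; ∈-upTo⁻; ∈-cartesianProduct⁺; ∈-cartesianProduct⁻)
  open import Data.List.Relation.Unary.Unique.Propositional.Properties using (allFin⁺)
  open import Data.Product using (_×_; _,_; proj₂)
  open import Data.Product.Properties using (≡-dec)
  open import Data.Sum using (_⊎_; inj₁; inj₂)
  open import Data.Empty using (⊥-elim)
  open import Relation.Nullary using (yes; no)
  open import Relation.Binary.PropositionalEquality
  open import Function.Definitions using (Injective)
  open FiniteSums

  -- Let F be strictly increasing and R an injection of a set of a·n indices into Fin a × ℕ.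
  -- Among all such R the sum of F over the second coordinates is least when R fills Fin a × [0, n),
  -- and every value beyond n - 1 costs at least one more:
  --   a · ∑_{k<n} F(k) + #{t : R(t)₂ > n - 1} ≤ ∑_t F(R(t)₂).
  -- Proof: with M = F(n-1), the defect D(j, k) = M - F(k) on Fin a × [0, n) (zero elsewhere) satisfies
  -- M + [R(t)₂ > n - 1] ≤ F(R(t)₂) + D(R(t)) termwise, while ∑_t D(R t) ≤ ∑_{Fin a × [0,n)} D = a·n·M - a·∑_{k<n} F(k).
  module _ (F : ℕ → ℕ) (F-strict : ∀ {k x} → k < x → F k < F x) where

    private
      F-mono : ∀ {k x} → k ≤ x → F k ≤ F x
      F-mono k≤x with m≤n⇒m<n∨m≡n k≤x
      ... | inj₁ k<x  = <⇒≤ (F-strict k<x)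
      ... | inj₂ refl = ≤-refl

      <⇒≤∸1 : ∀ {x n} → x < n → x ≤ n ∸ 1
      <⇒≤∸1 {n = suc n} (s≤s x≤n) = x≤n

    rearrangement : ∀ a n → 1 ≤ n → (R : Fin (a * n) → Fin a × ℕ) → Injective _≡_ _≡_ R →
                    a * ∑ (upTo n) F + ∑[ t ← allFin (a * n) ] ind (n ∸ 1 <? proj₂ (R t))
                      ≤ ∑[ t ← allFin (a * n) ] F (proj₂ (R t))
    rearrangement a n n≥1 R R-inj = +-cancelʳ-≤ (∑ L D) _ _ (begin
      a * ∑ (upTo n) F + Over + ∑ L D             ≡⟨ cong (λ s → s + Over + ∑ L D) (sym (∑-L-second F)) ⟩
      ∑ L (F ∘₂) + Over + ∑ L D                   ≡⟨ rotate (∑ L (F ∘₂)) Over (∑ L D) ⟩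
      ∑ L (F ∘₂) + ∑ L D + Over                   ≡⟨ cong (_+ Over) (sym (∑-+ L (F ∘₂) D)) ⟩
      ∑[ z ← L ] (F (proj₂ z) + D z) + Over       ≡⟨ cong (_+ Over) (∑-cong L fills) ⟩
      ∑[ z ← L ] M + Over                         ≡⟨ cong (_+ Over) (∑-L-second (λ _ → M)) ⟩
      a * ∑[ k ← upTo n ] M + Over                ≡⟨ cong (λ s → a * s + Over) (trans (∑-const (upTo n) M) (cong (_* M) (length-upTo n))) ⟩
      a * (n * M) + Over                          ≡⟨ cong (_+ Over) (sym (*-assoc a n M)) ⟩
      a * n * M + Over                            ≡⟨ cong (λ l → l * M + Over) (sym (length-tabulate {n = a * n} (λ t → t))) ⟩
      length T * M + Over                         ≡⟨ cong (_+ Over) (sym (∑-const T M)) ⟩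
      ∑[ t ← T ] M + Over                         ≡⟨ sym (∑-+ T (λ _ → M) _) ⟩
      ∑[ t ← T ] (M + ind (n ∸ 1 <? x t))         ≤⟨ ∑-mono T (λ {t} _ → termwise t) ⟩
      ∑[ t ← T ] (F (x t) + D (R t))              ≡⟨ ∑-+ T _ _ ⟩
      ∑[ t ← T ] F (x t) + ∑[ t ← T ] D (R t)     ≤⟨ +-monoʳ-≤ (∑[ t ← T ] F (x t)) defect-bound ⟩
      ∑[ t ← T ] F (x t) + ∑ L D                  ∎)
      where
      open ≤-Reasoning
      T = allFin (a * n)
      L = cartesianProduct (allFin a) (upTo n)
      x : Fin (a * n) → ℕ
      x t = proj₂ (R t)
      Over = ∑[ t ← T ] ind (n ∸ 1 <? x t)
      M = F (n ∸ 1)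
      _∘₂ : (ℕ → ℕ) → Fin a × ℕ → ℕ
      (f ∘₂) z = f (proj₂ z)

      D : Fin a × ℕ → ℕ
      D (_ , k) with k <? n
      ... | yes _ = M ∸ F k
      ... | no _  = 0

      rotate : ∀ u v w → u + v + w ≡ u + w + v
      rotate u v w = trans (+-assoc u v w) (trans (cong (u +_) (+-comm v w)) (sym (+-assoc u w v)))

      ∑-L-second : (f : ℕ → ℕ) → ∑ L (f ∘₂) ≡ a * ∑ (upTo n) f
      ∑-L-second f = begin-equality
        ∑ L (f ∘₂)                     ≡⟨ ∑-cartesianProduct (allFin a) (upTo n) _ ⟩
        ∑[ j ← allFin a ] ∑ (upTo n) f ≡⟨ ∑-const (allFin a) _ ⟩
        length (allFin a) * ∑ (upTo n) f ≡⟨ cong (_* ∑ (upTo n) f) (length-tabulate {n = a} (λ j → j)) ⟩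
        a * ∑ (upTo n) f               ∎

      fills : ∀ {z} → z ∈ L → F (proj₂ z) + D z ≡ M
      fills {j , k} z∈L with k <? n
      ... | yes k<n = m+[n∸m]≡n (F-mono (<⇒≤∸1 k<n))
      ... | no k≮n  = ⊥-elim (k≮n (∈-upTo⁻ (proj₂ (∈-cartesianProduct⁻ (allFin a) (upTo n) z∈L))))

      termwise : ∀ t → M + ind (n ∸ 1 <? x t) ≤ F (x t) + D (R t)
      termwise t with R t
      ... | j , k with k <? n | n ∸ 1 <? k
      ...   | yes k<n | yes n-1<k = ⊥-elim (<⇒≱ n-1<k (<⇒≤∸1 k<n))
      ...   | yes k<n | no _      = ≤-reflexive (trans (+-identityʳ M) (sym (m+[n∸m]≡n (F-mono (<⇒≤∸1 k<n)))))
      ...   | no _    | yes n-1<k = subst₂ _≤_ (+-comm 1 M) (sym (+-identityʳ (F k))) (F-strict n-1<k)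
      ...   | no k≮n  | no n-1≮k  = ⊥-elim (n-1≮k (<-≤-trans (∸-monoʳ-< {n} {1} {0} (s≤s ℕ.z≤n) n≥1) (≮⇒≥ k≮n)))

      defect-bound : ∑[ t ← T ] D (R t) ≤ ∑ L D
      defect-bound = ∑-injection (≡-dec Fin._≟_ ℕ._≟_) T L R (λ t → D (R t)) D (allFin⁺ (a * n))
        (λ _ _ e → R-inj e) (λ _ → ≤-refl) on-block
        where
        on-block : ∀ {t} → t ∈ T → D (R t) ≡ 0 ⊎ R t ∈ L
        on-block {t} _ with R t
        ... | j , k with k <? n
        ...   | yes k<n = inj₂ (∈-cartesianProduct⁺ (∈-allFin j) (∈-upTo⁺ k<n))
        ...   | no _    = inj₁ refl

module ShiftedFloors where

  open import Data.Nat as ℕ using (ℕ; suc; _+_; _*_; _∸_; _≤_; _<_; NonZero; _/_; _%_; _≤?_; s≤s)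
  open import Data.Nat.Properties
  open import Data.Nat.DivMod
  open import Data.Nat.Divisibility using (n∣m*n)
  open import Data.Nat.Tactic.RingSolver using (solve-∀)
  open import Data.Sum using (inj₁; inj₂)
  open import Relation.Nullary using (yes; no)
  open import Relation.Binary.PropositionalEquality
  open FiniteSums using (ind)

  /-+-* : ∀ m k d .{{_ : NonZero d}} → (m + k * d) / d ≡ m / d + k
  /-+-* m k d = trans (+-distrib-/-∣ʳ m (n∣m*n k)) (cong (m / d +_) (m*n/n≡m k d))

  floor-shift : ∀ d ρ .{{_ : NonZero d}} → ρ < d → ∀ x → (x + (d ∸ ρ)) / d ≡ x / d + ind (ρ ≤? x % d)
  floor-shift d ρ ρ<d x = begin
    (x + θ) / d                          ≡⟨ cong (λ y → (y + θ) / d) (m≡m%n+[m/n]*n x d) ⟩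
    (x % d + x / d * d + θ) / d          ≡⟨ cong (_/ d) (regroup (x % d) (x / d * d) θ) ⟩
    (x % d + θ + x / d * d) / d          ≡⟨ /-+-* (x % d + θ) (x / d) d ⟩
    (x % d + θ) / d + x / d              ≡⟨ cong (_+ x / d) (residue (x % d) (m%n<n x d)) ⟩
    ind (ρ ≤? x % d) + x / d             ≡⟨ +-comm _ (x / d) ⟩
    x / d + ind (ρ ≤? x % d)             ∎
    where
    open ≡-Reasoning
    θ = d ∸ ρ
    regroup : ∀ a b c → a + b + c ≡ a + c + b
    regroup = solve-∀
    residue : ∀ r → r < d → (r + θ) / d ≡ ind (ρ ≤? r)
    residue r r<d with ρ ≤? r
    ... | yes ρ≤r = trans (cong (_/ d) carry) (trans (/-+-* (r ∸ ρ) 1 d) (cong (_+ 1) (m<n⇒m/n≡0 (≤-<-trans (m∸n≤m r ρ) r<d))))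
      where
      carry : r + θ ≡ r ∸ ρ + 1 * d
      carry = begin
        r + (d ∸ ρ)               ≡⟨ cong (_+ (d ∸ ρ)) (sym (m∸n+n≡m ρ≤r)) ⟩
        r ∸ ρ + ρ + (d ∸ ρ)       ≡⟨ +-assoc (r ∸ ρ) ρ (d ∸ ρ) ⟩
        r ∸ ρ + (ρ + (d ∸ ρ))     ≡⟨ cong (r ∸ ρ +_) (trans (m+[n∸m]≡n (<⇒≤ ρ<d)) (sym (*-identityˡ d))) ⟩
        r ∸ ρ + 1 * d             ∎
    ... | no ρ≰r = m<n⇒m/n≡0 (subst (r + θ <_) (m+[n∸m]≡n (<⇒≤ ρ<d)) (+-monoˡ-< θ (≰⇒> ρ≰r)))

  module StepFunctions (p d c θ : ℕ) .{{_ : NonZero d}} where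

    G : ℕ → ℕ
    G x = (p * x + c + θ) / d

    H : ℕ → ℕ
    H x = (x + θ) / d

    F : ℕ → ℕ
    F x = G x ∸ H x

    H≤G : 1 ≤ p → ∀ x → H x ≤ G x
    H≤G p≥1 x = /-monoˡ-≤ d (+-monoˡ-≤ θ (≤-trans (m≤n*m x p {{ℕ.>-nonZero p≥1}}) (m≤m+n (p * x) c)))

    -- When p ≥ 2d, G grows by at least 2 and H by at most 1 per step, so F is strictly increasing.
    F-strict : 2 * d ≤ p → ∀ {k x} → k < x → F k < F x
    F-strict 2d≤p = strict
      where
      p≥1 : 1 ≤ p
      p≥1 = ≤-trans (≤-trans (ℕ.>-nonZero⁻¹ d) (m≤m+n d (d + 0))) 2d≤p

      G-step : ∀ x → G x + 2 ≤ G (suc x)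
      G-step x = begin
        G x + 2                              ≡⟨ sym (/-+-* (p * x + c + θ) 2 d) ⟩
        (p * x + c + θ + 2 * d) / d          ≤⟨ /-monoˡ-≤ d (+-monoʳ-≤ (p * x + c + θ) 2d≤p) ⟩
        (p * x + c + θ + p) / d              ≡⟨ cong (_/ d) (sym (next p x c θ)) ⟩
        G (suc x)                            ∎
        where
        open ≤-Reasoning
        next : ∀ p x c t → p * suc x + c + t ≡ p * x + c + t + p
        next = solve-∀

      H-step : ∀ x → H (suc x) ≤ H x + 1
      H-step x = begin
        (suc x + θ) / d           ≡⟨ cong (_/ d) (+-comm 1 (x + θ)) ⟩
        (x + θ + 1) / d           ≤⟨ /-monoˡ-≤ d (+-monoʳ-≤ (x + θ) (subst (1 ≤_) (sym (*-identityˡ d)) (ℕ.>-nonZero⁻¹ d))) ⟩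
        (x + θ + 1 * d) / d       ≡⟨ /-+-* (x + θ) 1 d ⟩
        H x + 1                   ∎
        where open ≤-Reasoning

      F-step : ∀ x → suc (F x) ≤ F (suc x)
      F-step x = begin
        suc (F x)                 ≡⟨ sym (+-∸-assoc 1 (H≤G p≥1 x)) ⟩
        suc (G x) ∸ H x           ≡⟨ cong₂ _∸_ (+-comm 2 (G x)) (+-comm 1 (H x)) ⟩
        (G x + 2) ∸ (H x + 1)     ≤⟨ ∸-mono (G-step x) (H-step x) ⟩
        F (suc x)                 ∎
        where open ≤-Reasoning

      strict : ∀ {k x} → k < x → F k < F x
      strict {k} {suc x} (s≤s k≤x) with m≤n⇒m<n∨m≡n k≤x
      ... | inj₁ k<x  = ≤-trans (s≤s (<⇒≤ (strict k<x))) (F-step x)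
      ... | inj₂ refl = F-step k

module ResidueCounting where

  open import Data.Nat as ℕ using (ℕ; zero; suc; _+_; _*_; _∸_; _≤_; _<_; z≤n; s≤s; NonZero; _/_; _%_; _≤?_; _<?_)
  open import Data.Nat.Properties
  open import Data.Nat.DivMod
  open import Data.Nat.Tactic.RingSolver using (solve-∀)
  open import Data.List using (upTo; length)
  open import Data.List.Properties using (length-upTo)
  open import Data.List.Membership.Propositional using (_∈_)
  open import Data.List.Membership.Propositional.Properties using (∈-upTo⁺; ∈-upTo⁻)
  open import Data.List.Relation.Unary.Unique.Propositional.Properties using (upTo⁺)
  open import Data.List.Relation.Unary.Any as Any using (any?)
  open import Data.Sum using (_⊎_; inj₁; inj₂)
  open import Data.Empty using (⊥-elim)
  open import Relation.Nullary using (yes; no)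
  open import Relation.Binary.PropositionalEquality
  open FiniteSums
  open ShiftedFloors

  ∑-periodic : ∀ d .{{_ : NonZero d}} (h : ℕ → ℕ) n →
               ∑[ k ← upTo n ] h (k % d) ≡ n / d * ∑ (upTo d) h + ∑ (upTo (n % d)) h
  ∑-periodic d h n = begin
    ∑[ k ← upTo n ] h (k % d)                         ≡⟨ cong (λ m → ∑[ k ← upTo m ] h (k % d)) n≡ ⟩
    ∑[ k ← upTo (n / d * d + n % d) ] h (k % d)       ≡⟨ ∑-upTo-+ (n / d * d) (n % d) _ ⟩
    ∑[ k ← upTo (n / d * d) ] h (k % d) + ∑[ i ← upTo (n % d) ] h ((n / d * d + i) % d)
      ≡⟨ cong₂ _+_ (periods (n / d)) (∑-cong (upTo (n % d)) (λ i∈ → cong h (tail i∈))) ⟩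
    n / d * ∑ (upTo d) h + ∑ (upTo (n % d)) h         ∎
    where
    open ≡-Reasoning
    n≡ : n ≡ n / d * d + n % d
    n≡ = trans (m≡m%n+[m/n]*n n d) (+-comm (n % d) _)
    tail : ∀ {i} → i ∈ upTo (n % d) → (n / d * d + i) % d ≡ i
    tail {i} i∈ = trans (cong (_% d) (+-comm (n / d * d) i))
                    (trans ([m+kn]%n≡m%n i (n / d) d) (m<n⇒m%n≡m (<-trans (∈-upTo⁻ i∈) (m%n<n n d))))
    periods : ∀ Q → ∑[ k ← upTo (Q * d) ] h (k % d) ≡ Q * ∑ (upTo d) h
    periods zero    = refl
    periods (suc Q) = begin
      ∑[ k ← upTo (d + Q * d) ] h (k % d)                          ≡⟨ ∑-upTo-+ d (Q * d) _ ⟩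
      ∑[ k ← upTo d ] h (k % d) + ∑[ i ← upTo (Q * d) ] h ((d + i) % d)
        ≡⟨ cong₂ _+_ (∑-cong (upTo d) (λ k∈ → cong h (m<n⇒m%n≡m (∈-upTo⁻ k∈))))
                     (∑-cong (upTo (Q * d)) (λ {i} _ → cong h (trans (cong (_% d) (+-comm d i)) ([m+n]%n≡m%n i d)))) ⟩
      ∑ (upTo d) h + ∑[ i ← upTo (Q * d) ] h (i % d)              ≡⟨ cong (∑ (upTo d) h +_) (periods Q) ⟩
      ∑ (upTo d) h + Q * ∑ (upTo d) h                              ∎

  δ∈ : (p d c : ℕ) .{{_ : NonZero d}} → ℕ → ℕ
  δ∈ p d c y = ind (any? (λ l → (p * l + c) % d ℕ.≟ y) (upTo y))

  module Residues (p d c ρ : ℕ) .{{_ : NonZero d}} (ρ<d : ρ < d)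
                  (σ-injective : ∀ {r r′} → r < d → r′ < d → (p * r + c) % d ≡ (p * r′ + c) % d → r ≡ r′) where

    σ : ℕ → ℕ
    σ r = (p * r + c) % d

    δ′ : ℕ → ℕ
    δ′ = δ∈ p d c

    δ′-hit : ∀ {l y} → l < y → σ l ≡ y → δ′ y ≡ 1
    δ′-hit {l} {y} l<y σl≡y with any? (λ l → σ l ℕ.≟ y) (upTo y)
    ... | yes _  = refl
    ... | no none = ⊥-elim (none (Any.map (λ { refl → σl≡y }) (∈-upTo⁺ l<y)))

    E₁ E₂ : ℕ → ℕ
    E₁ r = ind (r <? σ r) + ind (ρ ≤? r)
    E₂ r = ind (ρ ≤? σ r) + δ′ r

    private
      σ<d : ∀ r → σ r < d
      σ<d r = m%n<n (p * r + c) d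

      injective-below : ∀ m → m ≤ d → InjectiveOn (upTo m) σ
      injective-below m m≤d r∈ r′∈ = σ-injective (<-≤-trans (∈-upTo⁻ r∈) m≤d) (<-≤-trans (∈-upTo⁻ r′∈) m≤d)

      -- an ascent r < σ(r) is recorded by δ′ at σ(r), and σ is injective
      ascents : ∀ m → m ≤ d → ∑[ r ← upTo m ] (ind (r <? σ r) * ind (σ r <? m)) ≤ ∑ (upTo m) δ′
      ascents m m≤d = ∑-injection ℕ._≟_ (upTo m) (upTo m) σ _ δ′ (upTo⁺ m) (injective-below m m≤d) hit inside
        where
        hit : ∀ {r} → r ∈ upTo m → ind (r <? σ r) * ind (σ r <? m) ≤ δ′ (σ r)
        hit {r} _ with r <? σ r | σ r <? m
        ... | yes r<σr | yes _ = ≤-reflexive (sym (δ′-hit r<σr refl))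
        ... | yes _    | no _  = z≤n
        ... | no _     | _     = z≤n
        inside : ∀ {r} → r ∈ upTo m → ind (r <? σ r) * ind (σ r <? m) ≡ 0 ⊎ σ r ∈ upTo m
        inside {r} _ with σ r <? m
        ... | yes σr<m = inj₂ (∈-upTo⁺ σr<m)
        ... | no _     = inj₁ (*-zeroʳ (ind (r <? σ r)))

      indicator-split : ∀ x → ind (ρ ≤? x) + ind (x <? ρ) ≡ 1
      indicator-split x with ρ ≤? x | x <? ρ
      ... | yes ρ≤x | yes x<ρ = ⊥-elim (<⇒≱ x<ρ ρ≤x)
      ... | yes _   | no _    = refl
      ... | no _    | yes _   = refl
      ... | no ρ≰x  | no x≮ρ  = ⊥-elim (ρ≰x (≮⇒≥ x≮ρ))

      -- σ permutes [0, d), so it cannot raise the number of residues ≥ ρ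
      above-ρ : ∑[ r ← upTo d ] ind (ρ ≤? r) ≤ ∑[ r ← upTo d ] ind (ρ ≤? σ r)
      above-ρ = +-cancelʳ-≤ (∑[ r ← upTo d ] ind (σ r <? ρ)) _ _ (begin
        ∑[ r ← upTo d ] ind (ρ ≤? r) + ∑[ r ← upTo d ] ind (σ r <? ρ)
          ≤⟨ +-monoʳ-≤ (∑[ r ← upTo d ] ind (ρ ≤? r)) below-ρ ⟩
        ∑[ r ← upTo d ] ind (ρ ≤? r) + ∑[ r ← upTo d ] ind (r <? ρ)   ≡⟨ split (λ r → r) ⟩
        d                                                             ≡⟨ sym (split σ) ⟩
        ∑[ r ← upTo d ] ind (ρ ≤? σ r) + ∑[ r ← upTo d ] ind (σ r <? ρ) ∎)
        where
        open ≤-Reasoning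
        below-ρ : ∑[ r ← upTo d ] ind (σ r <? ρ) ≤ ∑[ r ← upTo d ] ind (r <? ρ)
        below-ρ = ∑-injection ℕ._≟_ (upTo d) (upTo d) σ _ (λ y → ind (y <? ρ)) (upTo⁺ d) (injective-below d ≤-refl)
                    (λ _ → ≤-refl) (λ {r} _ → inj₂ (∈-upTo⁺ (σ<d r)))
        split : ∀ (f : ℕ → ℕ) → ∑[ r ← upTo d ] ind (ρ ≤? f r) + ∑[ r ← upTo d ] ind (f r <? ρ) ≡ d
        split f = begin-equality
          ∑[ r ← upTo d ] ind (ρ ≤? f r) + ∑[ r ← upTo d ] ind (f r <? ρ) ≡⟨ sym (∑-+ (upTo d) _ _) ⟩
          ∑[ r ← upTo d ] (ind (ρ ≤? f r) + ind (f r <? ρ))             ≡⟨ ∑-cong (upTo d) (λ {r} _ → indicator-split (f r)) ⟩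
          ∑[ r ← upTo d ] 1                                              ≡⟨ ∑-const (upTo d) 1 ⟩
          length (upTo d) * 1                                            ≡⟨ trans (*-identityʳ _) (length-upTo d) ⟩
          d                                                              ∎

    full-period : ∑ (upTo d) E₁ ≤ ∑ (upTo d) E₂
    full-period = begin
      ∑ (upTo d) E₁                                                       ≡⟨ ∑-+ (upTo d) _ _ ⟩
      ∑[ r ← upTo d ] ind (r <? σ r) + ∑[ r ← upTo d ] ind (ρ ≤? r)        ≤⟨ +-mono-≤ ascents′ above-ρ ⟩
      ∑ (upTo d) δ′ + ∑[ r ← upTo d ] ind (ρ ≤? σ r)                      ≡⟨ +-comm (∑ (upTo d) δ′) _ ⟩
      ∑[ r ← upTo d ] ind (ρ ≤? σ r) + ∑ (upTo d) δ′                      ≡⟨ sym (∑-+ (upTo d) _ _) ⟩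
      ∑ (upTo d) E₂                                                       ∎
      where
      open ≤-Reasoning
      -- every σ(r) lies below d, so the second factor in `ascents` is 1
      ascents′ : ∑[ r ← upTo d ] ind (r <? σ r) ≤ ∑ (upTo d) δ′
      ascents′ = ≤-trans (∑-mono (upTo d) below) (ascents d ≤-refl)
        where
        below : ∀ {r} → r ∈ upTo d → ind (r <? σ r) ≤ ind (r <? σ r) * ind (σ r <? d)
        below {r} _ with σ r <? d
        ... | yes _   = ≤-reflexive (sym (*-identityʳ _))
        ... | no σr≮d = ⊥-elim (σr≮d (σ<d r))

    initial-segment : ∑ (upTo ρ) E₁ ≤ ∑ (upTo ρ) E₂
    initial-segment = begin
      ∑ (upTo ρ) E₁                                                          ≤⟨ ∑-mono (upTo ρ) (λ r∈ → below-ρ (∈-upTo⁻ r∈)) ⟩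
      ∑[ r ← upTo ρ ] (ind (ρ ≤? σ r) + ind (r <? σ r) * ind (σ r <? ρ))     ≡⟨ ∑-+ (upTo ρ) _ _ ⟩
      ∑[ r ← upTo ρ ] ind (ρ ≤? σ r) + ∑[ r ← upTo ρ ] (ind (r <? σ r) * ind (σ r <? ρ))
        ≤⟨ +-monoʳ-≤ (∑[ r ← upTo ρ ] ind (ρ ≤? σ r)) (ascents ρ (<⇒≤ ρ<d)) ⟩
      ∑[ r ← upTo ρ ] ind (ρ ≤? σ r) + ∑ (upTo ρ) δ′                         ≡⟨ sym (∑-+ (upTo ρ) _ _) ⟩
      ∑ (upTo ρ) E₂                                                          ∎
      where
      open ≤-Reasoning
      -- below ρ an ascent either ends at or above ρ, or stays below ρ
      below-ρ : ∀ {r} → r < ρ → E₁ r ≤ ind (ρ ≤? σ r) + ind (r <? σ r) * ind (σ r <? ρ)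
      below-ρ {r} r<ρ with r <? σ r | ρ ≤? r | ρ ≤? σ r | σ r <? ρ
      ... | _     | yes ρ≤r | _     | _      = ⊥-elim (<⇒≱ r<ρ ρ≤r)
      ... | no _  | no _    | _     | _      = z≤n
      ... | yes _ | no _    | yes _ | _      = s≤s z≤n
      ... | yes _ | no _    | no _  | yes _  = s≤s z≤n
      ... | yes _ | no _    | no ρ≰σr | no σr≮ρ = ⊥-elim (ρ≰σr (≮⇒≥ σr≮ρ))

    residue-sum : ∀ n → n % d ≡ ρ → ∑[ k ← upTo n ] E₁ (k % d) ≤ ∑[ k ← upTo n ] E₂ (k % d)
    residue-sum n n%d≡ρ = begin
      ∑[ k ← upTo n ] E₁ (k % d)                         ≡⟨ ∑-periodic d E₁ n ⟩
      n / d * ∑ (upTo d) E₁ + ∑ (upTo (n % d)) E₁        ≡⟨ cong (λ m → n / d * ∑ (upTo d) E₁ + ∑ (upTo m) E₁) n%d≡ρ ⟩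
      n / d * ∑ (upTo d) E₁ + ∑ (upTo ρ) E₁              ≤⟨ +-mono-≤ (*-monoʳ-≤ (n / d) full-period) initial-segment ⟩
      n / d * ∑ (upTo d) E₂ + ∑ (upTo ρ) E₂              ≡⟨ cong (λ m → n / d * ∑ (upTo d) E₂ + ∑ (upTo m) E₂) (sym n%d≡ρ) ⟩
      n / d * ∑ (upTo d) E₂ + ∑ (upTo (n % d)) E₂        ≡⟨ sym (∑-periodic d E₂ n) ⟩
      ∑[ k ← upTo n ] E₂ (k % d)                         ∎
      where open ≤-Reasoning

  -- Let n ≡ ρ (mod d), θ = d - ρ, and let K(k) be at most
  -- ⌈((p-1)k + c)/d⌉, i.e. K(k)·d < (p-1)k + c + d.
  -- Termwise, K(k) + H(k) ≤ ⌊(pk+c)/d⌋ + E₁(k mod d) and G(k) + δ′(k mod d) = ⌊(pk+c)/d⌋ + E₂(k mod d);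
  -- summing and comparing the residue weights gives the claim after cancelling ∑ H.
  module _ (p d c ρ : ℕ) .{{_ : NonZero d}} (ρ<d : ρ < d) (p≥1 : 1 ≤ p)
           (σ-injective : ∀ {r r′} → r < d → r′ < d → (p * r + c) % d ≡ (p * r′ + c) % d → r ≡ r′) where

    open Residues p d c ρ ρ<d σ-injective
    open StepFunctions p d c (d ∸ ρ)

    private
      Q : ℕ → ℕ
      Q k = (p * k + c) / d

      σ-mod : ∀ k → (p * k + c) % d ≡ σ (k % d)
      σ-mod k = begin
        (p * k + c) % d                              ≡⟨ cong (λ m → (p * m + c) % d) (trans (m≡m%n+[m/n]*n k d) (+-comm (k % d) _)) ⟩
        (p * (k / d * d + k % d) + c) % d            ≡⟨ cong (_% d) (expand p (k / d) d (k % d) c) ⟩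
        (p * (k % d) + c + p * (k / d) * d) % d      ≡⟨ [m+kn]%n≡m%n (p * (k % d) + c) (p * (k / d)) d ⟩
        σ (k % d)                                    ∎
        where
        open ≡-Reasoning
        expand : ∀ p q d r c → p * (q * d + r) + c ≡ p * r + c + p * q * d
        expand = solve-∀

      key : ∀ κ k → κ * d < (p ∸ 1) * k + c + d → (κ + k / d) * d + k % d < (p * k + c) % d + suc (Q k) * d
      key κ k bound = begin-strict
        (κ + k / d) * d + k % d           ≡⟨ regroup κ (k / d) d (k % d) ⟩
        κ * d + (k % d + k / d * d)       ≡⟨ cong (κ * d +_) (sym (m≡m%n+[m/n]*n k d)) ⟩
        κ * d + k                         <⟨ +-monoˡ-< k bound ⟩
        (p ∸ 1) * k + c + d + k           ≡⟨ move ((p ∸ 1) * k) c d k ⟩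
        (p ∸ 1) * k + k + c + d           ≡⟨ cong (λ m → m + c + d) p-1+1 ⟩
        p * k + c + d                     ≡⟨ cong (_+ d) (m≡m%n+[m/n]*n (p * k + c) d) ⟩
        (p * k + c) % d + Q k * d + d     ≡⟨ close ((p * k + c) % d) (Q k) d ⟩
        (p * k + c) % d + suc (Q k) * d   ∎
        where
        open ≤-Reasoning
        regroup : ∀ κ b d r → (κ + b) * d + r ≡ κ * d + (r + b * d)
        regroup = solve-∀
        move : ∀ x c d k → x + c + d + k ≡ x + k + c + d
        move = solve-∀
        close : ∀ s a d → s + a * d + d ≡ s + (d + a * d)
        close = solve-∀
        p-1+1 : (p ∸ 1) * k + k ≡ p * k
        p-1+1 = trans (cong ((p ∸ 1) * k +_) (sym (*-identityˡ k)))
                  (trans (sym (*-distribʳ-+ k (p ∸ 1) 1)) (cong (_* k) (m∸n+n≡m p≥1)))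

      quotient-bound : ∀ κ k → κ * d < (p ∸ 1) * k + c + d → κ + k / d ≤ Q k + ind (k % d <? (p * k + c) % d)
      quotient-bound κ k bound with k % d <? (p * k + c) % d
      ... | yes r<s = subst (κ + k / d ≤_) (+-comm 1 (Q k)) (≤-pred (*-cancelʳ-< d _ _ (begin-strict
            (κ + k / d) * d                          ≤⟨ m≤m+n _ (k % d) ⟩
            (κ + k / d) * d + k % d                  <⟨ key κ k bound ⟩
            (p * k + c) % d + suc (Q k) * d          <⟨ +-monoˡ-< (suc (Q k) * d) (m%n<n (p * k + c) d) ⟩
            suc (suc (Q k)) * d                      ∎)))
        where open ≤-Reasoning
      ... | no r≮s = subst (κ + k / d ≤_) (sym (+-identityʳ (Q k))) (≤-pred (*-cancelʳ-< d _ _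
            (+-cancelʳ-< (k % d) _ _ (begin-strict
              (κ + k / d) * d + k % d                <⟨ key κ k bound ⟩
              (p * k + c) % d + suc (Q k) * d        ≤⟨ +-monoˡ-≤ (suc (Q k) * d) (≮⇒≥ r≮s) ⟩
              k % d + suc (Q k) * d                  ≡⟨ +-comm (k % d) _ ⟩
              suc (Q k) * d + k % d                  ∎))))
        where open ≤-Reasoning

      lower : ∀ (K : ℕ → ℕ) → (∀ k → K k * d < (p ∸ 1) * k + c + d) → ∀ k → K k + H k ≤ Q k + E₁ (k % d)
      lower K K-bound k = begin
        K k + H k                                                    ≡⟨ cong (K k +_) (floor-shift d ρ ρ<d k) ⟩
        K k + (k / d + ind (ρ ≤? k % d))                             ≡⟨ sym (+-assoc (K k) _ _) ⟩
        K k + k / d + ind (ρ ≤? k % d)                               ≤⟨ +-monoˡ-≤ _ (quotient-bound (K k) k (K-bound k)) ⟩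
        Q k + ind (k % d <? (p * k + c) % d) + ind (ρ ≤? k % d)      ≡⟨ +-assoc (Q k) _ _ ⟩
        Q k + (ind (k % d <? (p * k + c) % d) + ind (ρ ≤? k % d))    ≡⟨ cong (λ y → Q k + (ind (k % d <? y) + ind (ρ ≤? k % d))) (σ-mod k) ⟩
        Q k + E₁ (k % d)                                             ∎
        where open ≤-Reasoning

      upper : ∀ k → G k + δ′ (k % d) ≡ Q k + E₂ (k % d)
      upper k = begin
        G k + δ′ (k % d)                                    ≡⟨ cong (_+ δ′ (k % d)) (floor-shift d ρ ρ<d (p * k + c)) ⟩
        Q k + ind (ρ ≤? (p * k + c) % d) + δ′ (k % d)       ≡⟨ +-assoc (Q k) _ _ ⟩
        Q k + (ind (ρ ≤? (p * k + c) % d) + δ′ (k % d))     ≡⟨ cong (λ y → Q k + (ind (ρ ≤? y) + δ′ (k % d))) (σ-mod k) ⟩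
        Q k + E₂ (k % d)                                    ∎
        where open ≡-Reasoning

    ceiling-sum-bound : (K : ℕ → ℕ) → (∀ k → K k * d < (p ∸ 1) * k + c + d) → ∀ n → n % d ≡ ρ →
                        ∑ (upTo n) K ≤ ∑ (upTo n) F + ∑[ k ← upTo n ] δ′ (k % d)
    ceiling-sum-bound K K-bound n n%d≡ρ = +-cancelʳ-≤ (∑ U H) _ _ (begin
      ∑ U K + ∑ U H                              ≡⟨ sym (∑-+ U K H) ⟩
      ∑[ k ← U ] (K k + H k)                     ≤⟨ ∑-mono U (λ {k} _ → lower K K-bound k) ⟩
      ∑[ k ← U ] (Q k + E₁ (k % d))              ≡⟨ ∑-+ U Q _ ⟩
      ∑ U Q + ∑[ k ← U ] E₁ (k % d)              ≤⟨ +-monoʳ-≤ (∑ U Q) (residue-sum n n%d≡ρ) ⟩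
      ∑ U Q + ∑[ k ← U ] E₂ (k % d)              ≡⟨ sym (∑-+ U Q _) ⟩
      ∑[ k ← U ] (Q k + E₂ (k % d))              ≡⟨ ∑-cong U (λ {k} _ → sym (upper k)) ⟩
      ∑[ k ← U ] (G k + δ′ (k % d))              ≡⟨ ∑-+ U G _ ⟩
      ∑ U G + Δ                                  ≡⟨ cong (_+ Δ) G≡F+H ⟩
      ∑ U F + ∑ U H + Δ                          ≡⟨ +-assoc (∑ U F) _ Δ ⟩
      ∑ U F + (∑ U H + Δ)                        ≡⟨ cong (∑ U F +_) (+-comm (∑ U H) Δ) ⟩
      ∑ U F + (Δ + ∑ U H)                        ≡⟨ sym (+-assoc (∑ U F) Δ _) ⟩
      ∑ U F + Δ + ∑ U H                          ∎)
      where
      open ≤-Reasoning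
      U = upTo n
      Δ = ∑[ k ← U ] δ′ (k % d)
      G≡F+H : ∑ U G ≡ ∑ U F + ∑ U H
      G≡F+H = trans (∑-cong U (λ {k} _ → sym (m∸n+n≡m (H≤G p≥1 k)))) (∑-+ U F H)

module Digits where

  open import Defs using (digit)
  open import Data.Nat as ℕ using (ℕ; zero; suc; _+_; _*_; _∸_; _^_; _≤_; _<_; z≤n; NonZero; _/_; _%_)
  open import Data.Nat.Properties
  open import Data.Nat.DivMod
  open import Data.Nat.Divisibility using (_∣_; divides; quotient; m∣n⇒n≡quotient*m; >⇒∤)
  open import Data.Nat.Coprimality using (Coprime; coprime-divisor)
  open import Data.Nat.Tactic.RingSolver using (solve-∀)
  open import Data.Sum using (inj₁; inj₂)
  open import Data.Empty using (⊥-elim)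
  open import Relation.Nullary using (¬_; yes; no)
  open import Relation.Binary.PropositionalEquality
  open ShiftedFloors using (/-+-*)

  digit-at-exponent : ∀ p u .{{_ : NonZero p}} → ℕ → ℕ
  digit-at-exponent p u j = (u / p ^ j) {{m^n≢0 p j}} % p

  0%n≡0 : ∀ n .{{_ : NonZero n}} → 0 % n ≡ 0
  0%n≡0 (suc _) = refl

  %-stable⇒∣ : ∀ d .{{_ : NonZero d}} X Y → (X + Y) % d ≡ X % d → d ∣ Y
  %-stable⇒∣ d X Y same = divides ((X + Y) / d ∸ X / d) (begin
    Y                                      ≡⟨ sym (m+n∸n≡m Y (X / d * d)) ⟩
    Y + X / d * d ∸ X / d * d              ≡⟨ cong (_∸ X / d * d) quotients ⟩
    (X + Y) / d * d ∸ X / d * d            ≡⟨ sym (*-distribʳ-∸ d ((X + Y) / d) (X / d)) ⟩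
    ((X + Y) / d ∸ X / d) * d              ∎)
    where
    open ≡-Reasoning
    quotients : Y + X / d * d ≡ (X + Y) / d * d
    quotients = +-cancelˡ-≡ (X % d) _ _ (begin
      X % d + (Y + X / d * d)             ≡⟨ swap (X % d) Y (X / d * d) ⟩
      Y + (X % d + X / d * d)             ≡⟨ cong (Y +_) (sym (m≡m%n+[m/n]*n X d)) ⟩
      Y + X                               ≡⟨ +-comm Y X ⟩
      X + Y                               ≡⟨ m≡m%n+[m/n]*n (X + Y) d ⟩
      (X + Y) % d + (X + Y) / d * d       ≡⟨ cong (_+ (X + Y) / d * d) same ⟩
      X % d + (X + Y) / d * d             ∎)
      where
      swap : ∀ a b c → a + (b + c) ≡ b + (a + c)
      swap = solve-∀

  -- For p coprime to d, the affine map r ↦ (pr + c) mod d is injective on [0, d): two residues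
  -- r ≤ r′ with equal images differ by a multiple of d below d, that is by 0.
  module _ (p d c : ℕ) .{{_ : NonZero d}} (coprime : Coprime d p) where

    private
      ordered : ∀ {r r′} → r ≤ r′ → r′ < d → (p * r + c) % d ≡ (p * r′ + c) % d → r ≡ r′
      ordered {r} {r′} r≤r′ r′<d same = trans (sym (+-identityˡ r)) (trans (cong (_+ r) (sym gap≡0)) (m∸n+n≡m r≤r′))
        where
        gap = r′ ∸ r
        shifted : p * r′ + c ≡ p * r + c + p * gap
        shifted = trans (cong (λ s → p * s + c) (sym (m+[n∸m]≡n r≤r′))) (expand p r gap c)
          where
          expand : ∀ p r e c → p * (r + e) + c ≡ p * r + c + p * e
          expand = solve-∀
        d∣gap : d ∣ gap
        d∣gap = coprime-divisor coprime (%-stable⇒∣ d (p * r + c) (p * gap) (trans (cong (_% d) (sym shifted)) (sym same)))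
        gap≡0 : gap ≡ 0
        gap≡0 with gap | d∣gap | ≤-<-trans (m∸n≤m r′ r) r′<d
        ... | zero  | _   | _   = refl
        ... | suc g | d∣g | g<d = ⊥-elim (>⇒∤ g<d d∣g)

    affine-injective : ∀ {r r′} → r < d → r′ < d → (p * r + c) % d ≡ (p * r′ + c) % d → r ≡ r′
    affine-injective {r} {r′} r<d r′<d same with ≤-total r r′
    ... | inj₁ r≤r′ = ordered r≤r′ r′<d same
    ... | inj₂ r′≤r = sym (ordered r′≤r r<d (sym same))

  -- Multiplying by p^b moves the top b digits to the bottom:
  --   p^b·u = v + H·(q - 1)  with  v = H + L·p^b < q,  and  ⌊v/p^b⌋ = L.
  module Rotation (p a b u : ℕ) .{{_ : NonZero p}} (b≤a : b ≤ a) (u<q : u < p ^ a) where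

    e q L H v : ℕ
    e = a ∸ b
    q = p ^ a

    instance
      p^b≢0 : NonZero (p ^ b)
      p^b≢0 = m^n≢0 p b
      p^e≢0 : NonZero (p ^ e)
      p^e≢0 = m^n≢0 p e

    L = u % p ^ e
    H = u / p ^ e
    v = H + L * p ^ b

    q≡ : q ≡ p ^ b * p ^ e
    q≡ = trans (cong (p ^_) (sym (m+[n∸m]≡n b≤a))) (^-distribˡ-+-* p b e)

    H<p^b : H < p ^ b
    H<p^b = m<n*o⇒m/o<n (subst (u <_) q≡ u<q)

    rotate : p ^ b * u ≡ v + H * (q ∸ 1)
    rotate = begin
      p ^ b * u                              ≡⟨ cong (p ^ b *_) (m≡m%n+[m/n]*n u (p ^ e)) ⟩
      p ^ b * (L + H * p ^ e)                ≡⟨ spread (p ^ b) L H (p ^ e) ⟩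
      L * p ^ b + H * (p ^ b * p ^ e)        ≡⟨ cong (λ m → L * p ^ b + H * m) (sym q≡) ⟩
      L * p ^ b + H * q                      ≡⟨ cong (λ m → L * p ^ b + H * m) (sym (m∸n+n≡m (m^n>0 p a))) ⟩
      L * p ^ b + H * (q ∸ 1 + 1)            ≡⟨ collect L (p ^ b) H (q ∸ 1) ⟩
      v + H * (q ∸ 1)                        ∎
      where
      open ≡-Reasoning
      spread : ∀ x l h y → x * (l + h * y) ≡ l * x + h * (x * y)
      spread = solve-∀
      collect : ∀ l x h m → l * x + h * (m + 1) ≡ (h + l * x) + h * m
      collect = solve-∀

    v<q : v < q
    v<q = begin-strict
      H + L * p ^ b       <⟨ +-monoˡ-< (L * p ^ b) H<p^b ⟩
      suc L * p ^ b       ≤⟨ *-monoˡ-≤ (p ^ b) (m%n<n u (p ^ e)) ⟩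
      p ^ e * p ^ b       ≡⟨ trans (*-comm (p ^ e) (p ^ b)) (sym q≡) ⟩
      q                   ∎
      where open ≤-Reasoning

    v/p^b≡L : v / p ^ b ≡ L
    v/p^b≡L = trans (/-+-* H L (p ^ b)) (trans (cong (_+ L) (m<n⇒m/n≡0 H<p^b)) (+-identityˡ L))

  -- The period b of u (the least b ≥ 1 with q - 1 ∣ p^b·u - u) is at most a, because b = a always works.
  period≤a : ∀ p a u b .{{_ : NonZero a}} →
             (∀ c → 1 ≤ c → c < b → ¬ ((p ^ a ∸ 1) ∣ (p ^ c * u ∸ u))) → b ≤ a
  period≤a p a u b minimal with b ℕ.≤? a
  ... | yes b≤a = b≤a
  ... | no b≰a  = ⊥-elim (minimal a (ℕ.>-nonZero⁻¹ a) (≰⇒> b≰a) (divides u a-works))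
    where
    a-works : p ^ a * u ∸ u ≡ u * (p ^ a ∸ 1)
    a-works = trans (cong (p ^ a * u ∸_) (sym (*-identityˡ u)))
                (trans (sym (*-distribʳ-∸ u (p ^ a) 1)) (*-comm (p ^ a ∸ 1) u))

  -- Rotating the digits of u by b places gives a
  -- number v < q congruent to p^b·u ≡ u modulo q - 1, hence v = u, and the digit u_b of u is the digit u_0 of v.
  digit-period : ∀ p a u b .{{_ : NonZero p}} .{{_ : NonZero a}} →
                 u + 2 ≤ p ^ a → (p ^ a ∸ 1) ∣ (p ^ b * u ∸ u) →
                 (∀ c → 1 ≤ c → c < b → ¬ ((p ^ a ∸ 1) ∣ (p ^ c * u ∸ u))) →
                 digit p a u b ≡ digit p a u 0
  digit-period p a u b u+2≤q q-1∣ minimal with m≤n⇒m<n∨m≡n (period≤a p a u b minimal)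
  ... | inj₂ refl = cong (digit-at-exponent p u) (trans (n%n≡0 b) (sym (0%n≡0 b)))
  ... | inj₁ b<a  = trans (cong (digit-at-exponent p u) (m<n⇒m%n≡m b<a)) (trans same-digit
                      (cong (digit-at-exponent p u) (sym (0%n≡0 a))))
    where
    open Rotation p a b u (<⇒≤ b<a) (≤-trans (n≤1+n (suc u)) (≤-trans (≤-reflexive (+-comm 2 u)) u+2≤q))
    u<q-1 : u < q ∸ 1
    u<q-1 = ∸-monoˡ-≤ 1 (≤-trans (≤-reflexive (+-comm 2 u)) u+2≤q)
    instance
      q-1≢0 : NonZero (q ∸ 1)
      q-1≢0 = ℕ.>-nonZero (≤-<-trans z≤n u<q-1)
    v≡u%q-1 : v % (q ∸ 1) ≡ u
    v≡u%q-1 = begin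
      v % (q ∸ 1)                        ≡⟨ sym ([m+kn]%n≡m%n v H (q ∸ 1)) ⟩
      (v + H * (q ∸ 1)) % (q ∸ 1)        ≡⟨ cong (_% (q ∸ 1)) (sym rotate) ⟩
      (p ^ b * u) % (q ∸ 1)              ≡⟨ cong (_% (q ∸ 1)) (sym (m+[n∸m]≡n (m≤n*m u (p ^ b) {{m^n≢0 p b}}))) ⟩
      (u + (p ^ b * u ∸ u)) % (q ∸ 1)    ≡⟨ cong (λ m → (u + m) % (q ∸ 1)) (m∣n⇒n≡quotient*m q-1∣) ⟩
      (u + quotient q-1∣ * (q ∸ 1)) % (q ∸ 1) ≡⟨ [m+kn]%n≡m%n u (quotient q-1∣) (q ∸ 1) ⟩
      u % (q ∸ 1)                        ≡⟨ m<n⇒m%n≡m u<q-1 ⟩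
      u                                  ∎
      where open ≡-Reasoning
    -- v < q, and v = q - 1 is impossible, so v equals its residue u
    v≡u : v ≡ u
    v≡u with m≤n⇒m<n∨m≡n (∸-monoˡ-≤ 1 v<q)
    ... | inj₁ v<q-1 = trans (sym (m<n⇒m%n≡m v<q-1)) v≡u%q-1
    ... | inj₂ v≡q-1 = ⊥-elim (n≮0 (subst (u <_) (trans (sym v≡q-1) v≡0) u<q-1))
      where
      -- v = q - 1 would force u = 0, and then v = 0 < q - 1
      u≡0 : u ≡ 0
      u≡0 = trans (sym v≡u%q-1) (trans (cong (_% (q ∸ 1)) v≡q-1) (n%n≡0 (q ∸ 1)))
      v≡0 : v ≡ 0
      v≡0 = cong₂ (λ h l → h + l * p ^ b) (trans (cong (_/ p ^ e) u≡0) (0/n≡0 (p ^ e))) (trans (cong (_% p ^ e) u≡0) (0%n≡0 (p ^ e)))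
    -- the digit of u at exponent b is the lowest digit of L = u mod p^e, i.e. of u
    same-digit : digit-at-exponent p u b ≡ digit-at-exponent p u 0
    same-digit = begin
      (u / p ^ b) % p          ≡⟨ cong (λ w → (w / p ^ b) % p) (sym v≡u) ⟩
      (v / p ^ b) % p          ≡⟨ cong (_% p) v/p^b≡L ⟩
      (u % p ^ e) % p          ≡⟨ m∣n⇒o%n%m≡o%m p (p ^ e) u (p∣p^ e (m<n⇒0<n∸m b<a)) ⟩
      u % p                    ≡⟨ cong (_% p) (sym (n/1≡n u)) ⟩
      (u / 1) % p              ∎
      where
      open ≡-Reasoning
      p∣p^ : ∀ k → 1 ≤ k → p ∣ p ^ k
      p∣p^ (suc k) _ = divides (p ^ k) (*-comm p (p ^ k))

module Polygon where

  open import Defs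
  open import Data.Nat as ℕ using (ℕ; zero; suc; NonZero; _∸_; _%_)
  import Data.Nat.Properties as ℕ
  open import Data.Nat.Tactic.RingSolver using (solve-∀)
  open import Data.Integer as ℤ using (ℤ; +_)
  import Data.Integer.Properties as ℤ
  open import Data.Rational as ℚ using (ℚ; 1ℚ; 0ℚ; _/_; ceiling)
  import Data.Rational.Properties as ℚ
  open import Data.Fin using (Fin)
  open import Data.List using ([]; _∷_; foldr; map; upTo; allFin)
  open import Data.List.Properties using (map-cong)
  open import Data.List.Relation.Unary.Any using (any?)
  open import Data.Bool using (if_then_else_)
  open import Data.Product using (proj₁)
  open import Relation.Nullary using (Dec; yes; no; does)
  open import Relation.Binary.PropositionalEquality
  open FiniteSums
  open CeilingBounds
  open IntegerEmbedding
  open ResidueCounting using (δ∈)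
  open Digits using (0%n≡0)

  -- ε(u) ≤ d: the minimum is at most its first term d·{x}′, and {x}′ = 1 + x - ⌈x⌉ ≤ 1.
  epsilon≤d : ∀ p a d u b .{{_ : NonZero p}} .{{_ : NonZero a}} .{{_ : NonZero d}} → epsilon p a d u b ℚ.≤ ℕtoℚ d
  epsilon≤d p a d u b = ℚ.≤-trans (foldr-⊓-≤ _ (map _ (upTo b)))
    (ℚ.≤-trans (ℚ.*-monoˡ-≤-nonNeg (ℕtoℚ d) {{ℚ.normalize-nonNeg d 1}} (fracP≤1 (x≤⌈x⌉ (+ digit p a u 1))))
               (ℚ.≤-reflexive (ℚ.*-identityʳ (ℕtoℚ d))))
    where
    foldr-⊓-≤ : ∀ x xs → foldr ℚ._⊓_ x xs ℚ.≤ x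
    foldr-⊓-≤ x []       = ℚ.≤-refl
    foldr-⊓-≤ x (y ∷ ys) = ℚ.≤-trans (ℚ.p⊓q≤q y _) (foldr-⊓-≤ x ys)

    x≤⌈x⌉ : ∀ z → z / d ℚ.≤ ⌈ z / d ⌉ℚ
    x≤⌈x⌉ z = /-≤ {z} {ceiling (z / d)} d 1
               (subst (ℤ._≤ ceiling (z / d) ℤ.* + d) (sym (ℤ.*-identityʳ z)) (proj₁ (ceiling-/-bounds z d)))

    fracP≤1 : ∀ {x} → x ℚ.≤ ⌈ x ⌉ℚ → fracP x ℚ.≤ 1ℚ
    fracP≤1 {x} x≤⌈x⌉ = begin
      1ℚ ℚ.+ x ℚ.- ⌈ x ⌉ℚ                ≤⟨ ℚ.+-monoˡ-≤ (ℚ.- ⌈ x ⌉ℚ) (ℚ.+-monoʳ-≤ 1ℚ x≤⌈x⌉) ⟩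
      1ℚ ℚ.+ ⌈ x ⌉ℚ ℚ.- ⌈ x ⌉ℚ           ≡⟨ ℚ.+-assoc 1ℚ ⌈ x ⌉ℚ (ℚ.- ⌈ x ⌉ℚ) ⟩
      1ℚ ℚ.+ (⌈ x ⌉ℚ ℚ.- ⌈ x ⌉ℚ)         ≡⟨ cong (1ℚ ℚ.+_) (ℚ.+-inverseʳ ⌈ x ⌉ℚ) ⟩
      1ℚ ℚ.+ 0ℚ                          ≡⟨ ℚ.+-identityʳ 1ℚ ⟩
      1ℚ                                 ∎
      where open ℚ.≤-Reasoning

  -- The hypothesis p > 4d - ε(u) gives p > 3d, in particular p ≥ 2d.
  ε-bound⇒2d≤p : ∀ p a d u b .{{_ : NonZero p}} .{{_ : NonZero a}} .{{_ : NonZero d}} →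
         ℚ._<_ (ℕtoℚ (4 ℕ.* d) ℚ.- epsilon p a d u b) (ℕtoℚ p) → 2 ℕ.* d ℕ.≤ p
  ε-bound⇒2d≤p p a d u b ε-bound = ℕ.≤-trans (ℕ.*-monoˡ-≤ d (ℕ.s≤s (ℕ.s≤s (ℕ.z≤n {1})))) (ℕ.<⇒≤ 3d<p)
    where
    4d-d<p : ℤtoℚ (+ (4 ℕ.* d) ℤ.- + d) ℚ.< ℕtoℚ p
    4d-d<p = subst (ℚ._< ℕtoℚ p) (sym (ℤtoℚ-- (+ (4 ℕ.* d)) (+ d)))
               (ℚ.≤-<-trans (ℚ.+-monoʳ-≤ (ℕtoℚ (4 ℕ.* d)) (ℚ.neg-antimono-≤ (epsilon≤d p a d u b))) ε-bound)
    3d<p : 3 ℕ.* d ℕ.< p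
    3d<p = subst (ℕ._< p) (trans (cong (_∸ d) (split d)) (ℕ.m+n∸n≡m (3 ℕ.* d) d))
             (ℤ.drop‿+<+ (subst (ℤ._< + p) (trans (ℤ.m-n≡m⊖n (4 ℕ.* d) d) (ℤ.⊖-≥ (ℕ.m≤n*m d 4))) (ℤtoℚ-cancel-< 4d-d<p)))
      where
      split : ∀ d → 4 ℕ.* d ≡ 3 ℕ.* d ℕ.+ d
      split = solve-∀

  if-ind : ∀ {P : Set} (X : Dec P) → (if does X then 1ℚ else 0ℚ) ≡ ℤtoℚ (+ ind X)
  if-ind (yes _) = refl
  if-ind (no _)  = refl

  ΣFin²-ℤtoℚ : ∀ b N (f : Fin b → Fin N → ℤ) →
               ΣFin b (λ i → ΣFin N (λ t → ℤtoℚ (f i t))) ≡ ℤtoℚ (∑ℤ (allFin b) (λ i → ∑ℤ (allFin N) (f i)))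
  ΣFin²-ℤtoℚ b N f = trans (cong sumℚ (map-cong (λ i → ℤtoℚ-∑ (allFin N) (f i)) (allFin b))) (ℤtoℚ-∑ (allFin b) _)

  module PolygonValue (p a d u b : ℕ) .{{_ : NonZero p}} .{{_ : NonZero a}} .{{_ : NonZero d}} .{{_ : NonZero b}} where

    K : ℕ → ℕ → ℕ
    K c k = ⌈ (p ∸ 1) ℕ.* k ℕ.+ c / d ⌉ℕ

    δ : ℕ → ℕ → ℕ
    δ c k = δ∈ p d c (k % d)

    private
      ĉ : ℕ → ℕ
      ĉ i = digit p a u (b ∸ i)

      deltaIn-value : ∀ i m → deltaIn p a d u b i m ≡ ℤtoℚ (+ δ (ĉ i) m)
      deltaIn-value i zero    = cong (λ y → ℤtoℚ (+ δ∈ p d (ĉ i) y)) (sym (0%n≡0 d))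
      deltaIn-value i (suc m) = if-ind (any? (λ l → (p ℕ.* l ℕ.+ ĉ i) % d ℕ.≟ suc m % d) (upTo (suc m % d)))

      W : ℕ → ℤ
      W k = + ∑[ i ← upTo b ] K (ĉ i) k ℤ.- + ∑[ i ← upTo b ] δ (ĉ i) k

      omega-value : ∀ k → omega p a d u b k ≡ (+ 1 / b) ℚ.* ℤtoℚ (W k)
      omega-value k = cong ((+ 1 / b) ℚ.*_) (begin
        sumℚ (map (λ i → ⌈ (+ ((p ∸ 1) ℕ.* k ℕ.+ ĉ i)) / d ⌉ℚ ℚ.- deltaIn p a d u b i k) (upTo b))
          ≡⟨ cong sumℚ (map-cong term (upTo b)) ⟩
        sumℚ (map (λ i → ℤtoℚ (+ K (ĉ i) k ℤ.- + δ (ĉ i) k)) (upTo b))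
          ≡⟨ ℤtoℚ-∑ (upTo b) _ ⟩
        ℤtoℚ (∑ℤ (upTo b) (λ i → + K (ĉ i) k ℤ.- + δ (ĉ i) k))
          ≡⟨ cong ℤtoℚ (∑ℤ-ℕ-∸ (upTo b) _ _) ⟩
        ℤtoℚ (W k) ∎)
        where
        open ≡-Reasoning
        term : ∀ i → ⌈ (+ ((p ∸ 1) ℕ.* k ℕ.+ ĉ i)) / d ⌉ℚ ℚ.- deltaIn p a d u b i k ≡ ℤtoℚ (+ K (ĉ i) k ℤ.- + δ (ĉ i) k)
        term i = trans (cong₂ (λ x y → ℤtoℚ x ℚ.- y) (ceiling-ℕ ((p ∸ 1) ℕ.* k ℕ.+ ĉ i) d) (deltaIn-value i k))
                       (sym (ℤtoℚ-- (+ K (ĉ i) k) (+ δ (ĉ i) k)))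

    polygon-value : ∀ n → ℕtoℚ (a ℕ.* b) ℚ.* arithPolygon p a d u b n ≡
                    ℤtoℚ (+ a ℤ.* (+ ∑[ i ← upTo b ] ∑[ k ← upTo n ] K (digit p a u (b ∸ i)) k
                                   ℤ.- + ∑[ i ← upTo b ] ∑[ k ← upTo n ] δ (digit p a u (b ∸ i)) k))
    polygon-value n = begin
      ℕtoℚ (a ℕ.* b) ℚ.* sumℚ (map (λ k → omega p a d u b k) (upTo n))
        ≡⟨ cong (λ s → ℕtoℚ (a ℕ.* b) ℚ.* sumℚ s) (map-cong omega-value (upTo n)) ⟩
      ℕtoℚ (a ℕ.* b) ℚ.* sumℚ (map (λ k → (+ 1 / b) ℚ.* ℤtoℚ (W k)) (upTo n))
        ≡⟨ cong (ℕtoℚ (a ℕ.* b) ℚ.*_) (trans (sumℚ-*ˡ (upTo n) (+ 1 / b) (λ k → ℤtoℚ (W k)))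
                                               (cong ((+ 1 / b) ℚ.*_) (ℤtoℚ-∑ (upTo n) W))) ⟩
      ℕtoℚ (a ℕ.* b) ℚ.* ((+ 1 / b) ℚ.* ℤtoℚ (∑ℤ (upTo n) W))
        ≡⟨ cancel-b (∑ℤ (upTo n) W) ⟩
      ℤtoℚ (+ a ℤ.* ∑ℤ (upTo n) W)
        ≡⟨ cong (λ v → ℤtoℚ (+ a ℤ.* v)) (trans (∑ℤ-ℕ-∸ (upTo n) _ _)
             (cong₂ (λ x y → + x ℤ.- + y) (∑-swap (upTo n) (upTo b) _) (∑-swap (upTo n) (upTo b) _))) ⟩
      ℤtoℚ (+ a ℤ.* (+ ∑[ i ← upTo b ] ∑[ k ← upTo n ] K (ĉ i) k ℤ.- + ∑[ i ← upTo b ] ∑[ k ← upTo n ] δ (ĉ i) k)) ∎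
      where
      open ≡-Reasoning
      cancel-b : ∀ v → ℕtoℚ (a ℕ.* b) ℚ.* ((+ 1 / b) ℚ.* ℤtoℚ v) ≡ ℤtoℚ (+ a ℤ.* v)
      cancel-b v = begin
        ℕtoℚ (a ℕ.* b) ℚ.* ((+ 1 / b) ℚ.* ℤtoℚ v)                     ≡⟨ cong (ℚ._* _) (trans (cong ℤtoℚ (ℤ.pos-* a b)) (ℤtoℚ-* (+ a) (+ b))) ⟩
        ℕtoℚ a ℚ.* ℕtoℚ b ℚ.* ((+ 1 / b) ℚ.* ℤtoℚ v)                   ≡⟨ ℚ.*-assoc (ℕtoℚ a) _ _ ⟩
        ℕtoℚ a ℚ.* (ℕtoℚ b ℚ.* ((+ 1 / b) ℚ.* ℤtoℚ v))                 ≡⟨ cong (ℕtoℚ a ℚ.*_) (sym (ℚ.*-assoc (ℕtoℚ b) _ _)) ⟩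
        ℕtoℚ a ℚ.* (ℕtoℚ b ℚ.* (+ 1 / b) ℚ.* ℤtoℚ v)                   ≡⟨ cong (λ x → ℕtoℚ a ℚ.* (x ℚ.* ℤtoℚ v)) (ℤtoℚ-*-1/ b) ⟩
        ℕtoℚ a ℚ.* (1ℚ ℚ.* ℤtoℚ v)                                     ≡⟨ cong (ℕtoℚ a ℚ.*_) (ℚ.*-identityˡ (ℤtoℚ v)) ⟩
        ℕtoℚ a ℚ.* ℤtoℚ v                                              ≡⟨ sym (ℤtoℚ-* (+ a) v) ⟩
        ℤtoℚ (+ a ℤ.* v)                                               ∎

open import Defs
open import Data.Nat as ℕ using (ℕ; suc; NonZero; _^_; _∸_; _≤_; _<_)
open import Data.Nat.Divisibility using (_∣_)
open import Data.Nat.Primality using (Prime)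
open import Data.Integer as ℤ using (+_)
open import Data.Rational as ℚ using (ℚ; _/_; _+_; _-_; _*_; ceiling; 1ℚ; 0ℚ)
open import Data.Fin using (Fin; toℕ)
open import Data.Product using (_×_; _,_; proj₁; proj₂)
open import Data.Bool using (if_then_else_)
open import Relation.Nullary using (¬_; does)
open import Relation.Binary.PropositionalEquality using (_≡_)
open import Function.Definitions using (Injective)
open import Function.Bundles using (_↔_; Inverse)

import Data.Nat.Properties as ℕ
open import Data.Nat.Coprimality using (Coprime; prime⇒coprime)
import Data.Nat.Coprimality as Coprime
open import Data.Nat.DivMod using (m%n<n)
import Data.Integer.Properties as ℤ
open import Data.Integer.Tactic.RingSolver using (solve-∀)
import Data.Nat.Tactic.RingSolver as ℕ-Ring
import Data.Fin as Fin
open import Data.List using (upTo; allFin; cartesianProduct)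
open import Data.List.Properties using (map-cong)
open import Data.List.Membership.Propositional using (_∈_)
open import Data.List.Membership.Propositional.Properties using (∈-allFin; ∈-cartesianProduct⁺)
open import Data.List.Relation.Unary.Unique.Propositional.Properties using (allFin⁺; cartesianProduct⁺)
open import Data.Product.Properties using (≡-dec)
open import Relation.Binary.PropositionalEquality using (refl; sym; trans; cong; cong₂; subst; subst₂)

open FiniteSums
open CeilingBounds
open IntegerEmbedding
open Rearrangement
open ShiftedFloors
open ResidueCounting
open Digits
open Polygon

-- The data of the theorem, with its arithmetic hypotheses already reduced to p ≥ 2d (from p > 4d - ε(u))
-- and the digit period u_b = u_0 (from the definition of b).
module Proof (p a d u b n : ℕ) .{{_ : NonZero p}} .{{_ : NonZero a}} .{{_ : NonZero d}} .{{_ : NonZero b}}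
             (p-prime : Prime p) (2d≤p : 2 ℕ.* d ≤ p) (period : digit p a u b ≡ digit p a u 0) (n≥1 : 1 ≤ n)
             (R : Fin b → Fin (a ℕ.* n) → Fin a × ℕ) (R-inj : ∀ i → Injective _≡_ _≡_ (R i))
             (τ : (Fin b × Fin (a ℕ.* n)) ↔ (Fin b × Fin (a ℕ.* n))) where

  open PolygonValue p a d u b using (K; δ; polygon-value)

  N ρ θ : ℕ
  N = a ℕ.* n
  ρ = n ℕ.% d
  θ = d ∸ ρ

  ρ<d : ρ < d
  ρ<d = m%n<n n d

  p≥1 : 1 ≤ p
  p≥1 = ℕ.>-nonZero⁻¹ p

  -- d < p, so d is coprime to the prime p
  coprime : Coprime d p
  coprime = Coprime.sym (prime⇒coprime p-prime d<p)
    where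
    d<p : d < p
    d<p = ℕ.<-≤-trans (ℕ.m<n+m d (ℕ.>-nonZero⁻¹ d)) (ℕ.≤-trans (ℕ.≤-reflexive (cong (d ℕ.+_) (sym (ℕ.+-identityʳ d)))) 2d≤p)

  c : Fin b → ℕ
  c i = digit p a u (b ∸ suc (toℕ i))

  x y : Fin b → Fin N → ℕ
  x i t = φ (R i t)
  y i t = x (proj₁ (Inverse.to τ (i , t))) (proj₂ (Inverse.to τ (i , t)))

  G F : Fin b → ℕ → ℕ
  G i = StepFunctions.G p d (c i) θ
  F i = StepFunctions.F p d (c i) θ
  H : ℕ → ℕ
  H = StepFunctions.H p d 0 θ   -- H does not involve the digit

  C : Fin b → Fin N → ℤ.ℤ
  C i t = ceiling ((+ (p ℕ.* x i t) ℤ.- + y i t ℤ.+ + c i) / d)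

  ∑₂ : (Fin b → Fin N → ℕ) → ℕ
  ∑₂ h = ∑[ i ← allFin b ] ∑[ t ← allFin N ] h i t

  ∑ℤ₂ : (Fin b → Fin N → ℤ.ℤ) → ℤ.ℤ
  ∑ℤ₂ h = ∑ℤ (allFin b) (λ i → ∑ℤ (allFin N) (h i))

  +-cancel : ∀ A B → A ℤ.+ B ℤ.- B ≡ A
  +-cancel = solve-∀

  -- ⌈(px - y + c)/d⌉ ≥ G(x) - H(y), from ⌊(z + w)/d⌋ ≤ ⌈z/d⌉ + ⌊w/d⌋ with z = px - y + c, w = y + θ
  term-bound : ∀ i t → + G i (x i t) ℤ.- + H (y i t) ℤ.≤ C i t
  term-bound i t = subst (λ r → + G i X ℤ.- + H Y ℤ.≤ r) (+-cancel (C i t) (+ H Y))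
    (ℤ.+-monoˡ-≤ (ℤ.- + H Y) (floor≤ceiling+floor z (Y ℕ.+ θ) (p ℕ.* X ℕ.+ c i ℕ.+ θ) d total))
    where
    X = x i t
    Y = y i t
    z = + (p ℕ.* X) ℤ.- + Y ℤ.+ + c i
    total : z ℤ.+ + (Y ℕ.+ θ) ≡ + (p ℕ.* X ℕ.+ c i ℕ.+ θ)
    total = trans (cong (λ w → z ℤ.+ w) (ℤ.pos-+ Y θ))
      (trans (ring (+ (p ℕ.* X)) (+ Y) (+ c i) (+ θ))
             (sym (trans (ℤ.pos-+ (p ℕ.* X ℕ.+ c i) θ) (cong (ℤ._+ + θ) (ℤ.pos-+ (p ℕ.* X) (c i))))))
      where
      ring : ∀ P Y C T → P ℤ.- Y ℤ.+ C ℤ.+ (Y ℤ.+ T) ≡ P ℤ.+ C ℤ.+ T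
      ring = solve-∀

  -- τ permutes the index set, so ∑ H(y) = ∑ H(x)
  H-permute : ∑₂ (λ i t → H (y i t)) ≡ ∑₂ (λ i t → H (x i t))
  H-permute = trans (sym (∑-cartesianProduct (allFin b) (allFin N) _))
    (trans (∑-permute (≡-dec Fin._≟_ Fin._≟_) P (cartesianProduct⁺ (allFin⁺ b) (allFin⁺ N)) complete τ
             (λ z → H (x (proj₁ z) (proj₂ z))))
           (∑-cartesianProduct (allFin b) (allFin N) _))
    where
    P = cartesianProduct (allFin b) (allFin N)
    complete : ∀ z → z ∈ P
    complete (i , t) = ∈-cartesianProduct⁺ (∈-allFin i) (∈-allFin t)

  ∑₂-+ : ∀ f g → ∑₂ (λ i t → f i t ℕ.+ g i t) ≡ ∑₂ f ℕ.+ ∑₂ g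
  ∑₂-+ f g = trans (∑-cong (allFin b) (λ {i} _ → ∑-+ (allFin N) (f i) (g i))) (∑-+ (allFin b) _ _)

  ∑ℤ₂-ℕ-∸ : ∀ f g → ∑ℤ₂ (λ i t → + f i t ℤ.- + g i t) ≡ + ∑₂ f ℤ.- + ∑₂ g
  ∑ℤ₂-ℕ-∸ f g = trans (∑ℤ-cong (allFin b) (λ i → ∑ℤ-ℕ-∸ (allFin N) (f i) (g i))) (∑ℤ-ℕ-∸ (allFin b) _ _)

  -- Step 1: the left-hand side is at least ∑ F(x), because ∑ (G(x) - H(y)) = ∑ (G(x) - H(x)).
  ceiling-sum : + ∑₂ (λ i t → F i (x i t)) ℤ.≤ ∑ℤ₂ C
  ceiling-sum = begin
    + ∑₂ Fx
      ≡⟨ sym (trans (cong (ℤ._- + ∑₂ Hx) (ℤ.pos-+ (∑₂ Fx) (∑₂ Hx))) (+-cancel (+ ∑₂ Fx) (+ ∑₂ Hx))) ⟩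
    + (∑₂ Fx ℕ.+ ∑₂ Hx) ℤ.- + ∑₂ Hx       ≡⟨ cong₂ (λ g h → + g ℤ.- + h) (sym G≡F+H) (sym H-permute) ⟩
    + ∑₂ Gx ℤ.- + ∑₂ Hy                   ≡⟨ sym (∑ℤ₂-ℕ-∸ Gx Hy) ⟩
    ∑ℤ₂ (λ i t → + Gx i t ℤ.- + Hy i t)   ≤⟨ ∑ℤ-mono (allFin b) (λ i → ∑ℤ-mono (allFin N) (term-bound i)) ⟩
    ∑ℤ₂ C                                 ∎
    where
    open ℤ.≤-Reasoning
    Fx Gx Hx Hy : Fin b → Fin N → ℕ
    Fx i t = F i (x i t)
    Gx i t = G i (x i t)
    Hx i t = H (x i t)
    Hy i t = H (y i t)
    G≡F+H : ∑₂ Gx ≡ ∑₂ Fx ℕ.+ ∑₂ Hx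
    G≡F+H = trans (∑-cong (allFin b) (λ {i} _ → ∑-cong (allFin N) (λ {t} _ →
                    sym (ℕ.m∸n+n≡m (StepFunctions.H≤G p d (c i) θ p≥1 (x i t))))))
                  (∑₂-+ Fx Hx)

  over : Fin b → Fin N → ℕ
  over i t = ind (n ∸ 1 ℕ.<? x i t)

  block-bound : ∀ i → a ℕ.* ∑ (upTo n) (K (c i)) ℕ.+ ∑ (allFin N) (over i)
                      ≤ ∑[ t ← allFin N ] F i (x i t) ℕ.+ a ℕ.* ∑ (upTo n) (δ (c i))
  block-bound i = begin
    a ℕ.* ∑ (upTo n) (K (c i)) ℕ.+ Over                  ≤⟨ ℕ.+-monoˡ-≤ Over (ℕ.*-monoʳ-≤ a ceilings) ⟩
    a ℕ.* (∑ (upTo n) (F i) ℕ.+ Δ) ℕ.+ Over              ≡⟨ regroup a (∑ (upTo n) (F i)) Δ Over ⟩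
    a ℕ.* ∑ (upTo n) (F i) ℕ.+ Over ℕ.+ a ℕ.* Δ          ≤⟨ ℕ.+-monoˡ-≤ (a ℕ.* Δ) rearranged ⟩
    ∑[ t ← allFin N ] F i (x i t) ℕ.+ a ℕ.* Δ            ∎
    where
    open ℕ.≤-Reasoning
    Over = ∑ (allFin N) (over i)
    Δ = ∑ (upTo n) (δ (c i))
    ceilings : ∑ (upTo n) (K (c i)) ≤ ∑ (upTo n) (F i) ℕ.+ Δ
    ceilings = ceiling-sum-bound p d (c i) ρ ρ<d p≥1 (affine-injective p d (c i) coprime)
                 (K (c i)) (λ k → ⌈/⌉ℕ-upper ((p ∸ 1) ℕ.* k ℕ.+ c i) d) n refl
    rearranged : a ℕ.* ∑ (upTo n) (F i) ℕ.+ Over ≤ ∑[ t ← allFin N ] F i (x i t)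
    rearranged = rearrangement (F i) (StepFunctions.F-strict p d (c i) θ 2d≤p) a n n≥1 (R i) (R-inj i)
    regroup : ∀ a f e o → a ℕ.* (f ℕ.+ e) ℕ.+ o ≡ a ℕ.* f ℕ.+ o ℕ.+ a ℕ.* e
    regroup = ℕ-Ring.solve-∀

  TK Tδ : ℕ
  TK = ∑[ i ← allFin b ] ∑ (upTo n) (K (c i))
  Tδ = ∑[ i ← allFin b ] ∑ (upTo n) (δ (c i))

  blocks-bound : a ℕ.* TK ℕ.+ ∑₂ over ≤ ∑₂ (λ i t → F i (x i t)) ℕ.+ a ℕ.* Tδ
  blocks-bound = begin
    a ℕ.* TK ℕ.+ ∑₂ over
      ≡⟨ trans (cong (ℕ._+ ∑₂ over) (sym (∑-*ˡ (allFin b) a _))) (sym (∑-+ (allFin b) _ _)) ⟩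
    ∑[ i ← allFin b ] (a ℕ.* ∑ (upTo n) (K (c i)) ℕ.+ ∑ (allFin N) (over i))
      ≤⟨ ∑-mono (allFin b) (λ {i} _ → block-bound i) ⟩
    ∑[ i ← allFin b ] (∑[ t ← allFin N ] F i (x i t) ℕ.+ a ℕ.* ∑ (upTo n) (δ (c i)))
      ≡⟨ trans (∑-+ (allFin b) _ _) (cong (∑₂ (λ i t → F i (x i t)) ℕ.+_) (∑-*ˡ (allFin b) a _)) ⟩
    ∑₂ (λ i t → F i (x i t)) ℕ.+ a ℕ.* Tδ
      ∎
    where open ℕ.≤-Reasoning

  integer-bound : + a ℤ.* (+ TK ℤ.- + Tδ) ℤ.+ + ∑₂ over ℤ.≤ ∑ℤ₂ C
  integer-bound = begin
    + a ℤ.* (+ TK ℤ.- + Tδ) ℤ.+ + ∑₂ over        ≡⟨ shuffle (+ a) (+ TK) (+ Tδ) (+ ∑₂ over) ⟩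
    + a ℤ.* + TK ℤ.+ + ∑₂ over ℤ.- + a ℤ.* + Tδ
      ≡⟨ cong₂ (λ l r → l ℤ.- r) (trans (cong (ℤ._+ + ∑₂ over) (sym (ℤ.pos-* a TK))) (sym (ℤ.pos-+ (a ℕ.* TK) _)))
                                (sym (ℤ.pos-* a Tδ)) ⟩
    + (a ℕ.* TK ℕ.+ ∑₂ over) ℤ.- + (a ℕ.* Tδ)   ≤⟨ ℤ.+-monoˡ-≤ (ℤ.- + (a ℕ.* Tδ)) (ℤ.+≤+ blocks-bound) ⟩
    + (∑₂ Fx ℕ.+ a ℕ.* Tδ) ℤ.- + (a ℕ.* Tδ)
      ≡⟨ trans (cong (ℤ._- + (a ℕ.* Tδ)) (ℤ.pos-+ (∑₂ Fx) _)) (+-cancel (+ ∑₂ Fx) (+ (a ℕ.* Tδ))) ⟩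
    + ∑₂ Fx                                      ≤⟨ ceiling-sum ⟩
    ∑ℤ₂ C                                        ∎
    where
    open ℤ.≤-Reasoning
    Fx : Fin b → Fin N → ℕ
    Fx i t = F i (x i t)
    shuffle : ∀ A K D O → A ℤ.* (K ℤ.- D) ℤ.+ O ≡ A ℤ.* K ℤ.+ O ℤ.- A ℤ.* D
    shuffle = solve-∀

  ceiling-side : ΣFin b (λ i → ΣFin N (λ t → ℤtoℚ (C i t))) ≡ ℤtoℚ (∑ℤ₂ C)
  ceiling-side = ΣFin²-ℤtoℚ b N C

  polygon-side : ℕtoℚ (a ℕ.* b) * arithPolygon p a d u b n
                   + ΣFin b (λ i → ΣFin N (λ t → if does (n ∸ 1 ℕ.<? φ (R i t)) then 1ℚ else 0ℚ))
                 ≡ ℤtoℚ (+ a ℤ.* (+ TK ℤ.- + Tδ) ℤ.+ + ∑₂ over)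
  polygon-side = trans (cong₂ _+_ polygon overshoot) (sym (ℤtoℚ-+ (+ a ℤ.* (+ TK ℤ.- + Tδ)) (+ ∑₂ over)))
    where
    -- the sum over the digits u_b, ..., u_1 is the sum over u_{b-1}, ..., u_0, since u_b = u_0
    rotate-digits : (f : ℕ → ℕ) → ∑[ i ← upTo b ] f (digit p a u (b ∸ i)) ≡ ∑[ i ← allFin b ] f (c i)
    rotate-digits f = trans (∑-rotate (λ j → f (digit p a u j)) b (cong f period))
                            (sym (∑-allFin b (λ j → f (digit p a u (b ∸ suc j)))))
    polygon : ℕtoℚ (a ℕ.* b) * arithPolygon p a d u b n ≡ ℤtoℚ (+ a ℤ.* (+ TK ℤ.- + Tδ))
    polygon = trans (polygon-value n) (cong (λ v → ℤtoℚ (+ a ℤ.* v))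
      (cong₂ (λ k e → + k ℤ.- + e) (rotate-digits (λ c → ∑ (upTo n) (K c))) (rotate-digits (λ c → ∑ (upTo n) (δ c)))))
    overshoot : ΣFin b (λ i → ΣFin N (λ t → if does (n ∸ 1 ℕ.<? φ (R i t)) then 1ℚ else 0ℚ)) ≡ ℤtoℚ (+ ∑₂ over)
    overshoot = trans (cong sumℚ (map-cong (λ i → cong sumℚ (map-cong (λ t → if-ind (n ∸ 1 ℕ.<? x i t)) (allFin N))) (allFin b)))
                      (trans (ΣFin²-ℤtoℚ b N (λ i t → + over i t))
                             (cong ℤtoℚ (trans (∑ℤ-cong (allFin b) (λ i → ∑ℤ-ℕ (allFin N) (over i))) (∑ℤ-ℕ (allFin b) _))))

mainTheorem9 : (p a d u b n : ℕ) .⦃ _ : NonZero p ⦄ .⦃ _ : NonZero a ⦄ .⦃ _ : NonZero d ⦄ .⦃ _ : NonZero b ⦄ →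
    Prime p →
    u ℕ.+ 2 ≤ p ^ a →
    (p ^ a ∸ 1) ∣ (p ^ b ℕ.* u ∸ u) →
    (∀ c → 1 ≤ c → c < b → ¬ ((p ^ a ∸ 1) ∣ (p ^ c ℕ.* u ∸ u))) →
    ℚ._<_ (ℕtoℚ (4 ℕ.* d) - epsilon p a d u b) (ℕtoℚ p) →
    1 ≤ n →
    (R : Fin b → Fin (a ℕ.* n) → Fin a × ℕ) →
    (∀ i → Injective _≡_ _≡_ (R i)) →
    (τ : (Fin b × Fin (a ℕ.* n)) ↔ (Fin b × Fin (a ℕ.* n))) →
    ℚ._≥_
      (ΣFin b (λ i → ΣFin (a ℕ.* n) (λ t →
        ℤtoℚ (ceiling
          ((+ (p ℕ.* φ (R i t))
            ℤ.- + φ (R (proj₁ (Inverse.to τ (i , t))) (proj₂ (Inverse.to τ (i , t))))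
            ℤ.+ + digit p a u (b ∸ suc (toℕ i))) / d)))))
      (ℕtoℚ (a ℕ.* b) * arithPolygon p a d u b n
        + ΣFin b (λ i → ΣFin (a ℕ.* n) (λ t →
            if does (n ∸ 1 ℕ.<? φ (R i t)) then 1ℚ else 0ℚ)))
mainTheorem9 p a d u b n p-prime u+2≤q q-1∣ minimal ε-bound n≥1 R R-inj τ =
  subst₂ ℚ._≤_ (sym polygon-side) (sym ceiling-side) (ℤtoℚ-mono-≤ integer-bound)
  where
  -- the hypotheses on u and ε(u) are used only through p ≥ 2d and u_b = u_0
  open Proof p a d u b n p-prime (ε-bound⇒2d≤p p a d u b ε-bound) (digit-period p a u b u+2≤q q-1∣ minimal) n≥1 R R-inj τ
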